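{- Let $\lambda$ be a nonzero real number and let $Y$ be uniformly distributed on $[0,1]$. Then \[ \log_{\lambda}^{Y}(1+t)=\sum_{n=1}^{\infty}S_{1,\lambda}^{Y}(n,1)\frac{t^{n}}{n!}=\sum_{n=1}^{\infty}2^{n}\sum_{m=0}^{n-1}\binom{n-1}{m}\sum_{j_1+\cdots+j_n=m}\binom{m}{j_1,\dots,j_n}A_{2,j_1}A_{2,j_2}\cdots A_{2,j_n}\lambda^{n-m-1}\frac{t^{n}}{n!}, \] the inner sum ranging over tuples of nonnegative integers.
   Context: $e_{\lambda}(t)=(1+\lambda t)^{1/\lambda}$. For $Y\sim U[0,1]$, $E[e_{\lambda}^{Y}(t)]=E[(1+\lambda t)^{Y/\lambda}]=\frac{e_{\lambda}(t)-1}{\log e_{\lambda}(t)}$, a power series with constant term $1$ and linear coefficient $1/2$. The probabilistic degenerate logarithm $\log_{\lambda}^{Y}(1+t)$ is the compositional inverse of the delta series $E[e_{\lambda}^{Y}(t)]-1$, and $S_{1,\lambda}^{Y}(n,1)$ is defined by $\log_{\lambda}^{Y}(1+t)=\sum_{n\ge1}S_{1,\lambda}^{Y}(n,1)\frac{t^n}{n!}$. The numbers $A_{2,n}$ are defined by $\frac{\frac{1}{2}t^{2}}{e^{t}-1-t}=\sum_{n\ge0}A_{2,n}\frac{t^{n}}{n!}$. -}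

module Defs where

open import Level using (Level)
open import Data.Nat as ℕ using (ℕ; zero; suc; _∸_)
open import Data.Nat.Combinatorics using (_C_)
open import Data.Nat using (_!)
open import Data.List using (List; []; _∷_; map; concatMap; upTo; foldr)
open import Data.Product using (_×_)
open import Algebra.Bundles using (CommutativeRing)

-- Formal power series over a commutative ring R in which every positive
-- integer n+1 is invertible (inverse supplied as `inv n`), i.e. R is a
-- ℚ-algebra.  ℝ is the instance relevant to the paper.
-- A power series is represented by its sequence of ORDINARY coefficients:
-- f : ℕ → Carrier stands for  Σ_n f n · t^n.

module Series {c ℓ : Level} (R : CommutativeRing c ℓ) where
  open CommutativeRing R

  fromℕ : ℕ → Carrier
  fromℕ zero = 0#
  fromℕ (suc n) = 1# + fromℕ n

  pw : Carrier → ℕ → Carrier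
  pw x zero = 1#
  pw x (suc k) = x * pw x k

  sumTo : ℕ → (ℕ → Carrier) → Carrier
  sumTo zero f = 0#
  sumTo (suc n) f = sumTo n f + f n

  sumL : List Carrier → Carrier
  sumL = foldr _+_ 0#

  prodL : List Carrier → Carrier
  prodL = foldr _*_ 1#

  PS : Set c
  PS = ℕ → Carrier

  oneS : PS
  oneS zero = 1#
  oneS (suc n) = 0#

  tS : PS
  tS zero = 0#
  tS (suc zero) = 1#
  tS (suc (suc n)) = 0#

  mulS : PS → PS → PS
  mulS f g n = sumTo (suc n) (λ k → f k * g (n ∸ k))

  powS : PS → ℕ → PS
  powS f zero = oneS
  powS f (suc j) = mulS f (powS f j)

  -- composition f(g(t)), meaningful when g 0 ≈ 0 (then g^j has no terms below t^j)
  compS : PS → PS → PS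
  compS f g n = sumTo (suc n) (λ j → f j * powS g j n)

  IsCompInverse : PS → PS → Set ℓ
  IsCompInverse f g = (g 0 ≈ 0#) × (∀ n → compS f g n ≈ tS n)

  module WithInverses (inv : ℕ → Carrier) where
    -- inv n = 1/(n+1);  invFact n = 1/n!
    invFact : ℕ → Carrier
    invFact zero = 1#
    invFact (suc n) = invFact n * inv n

    -- log e_λ(t) = (1/λ) log(1+λt) = Σ_{k≥0} (-1)^k λ^k t^{k+1}/(k+1)
    logeS : Carrier → PS
    logeS lam zero = 0#
    logeS lam (suc k) = pw (- 1#) k * pw lam k * inv k

    -- E[Y^j] for Y ~ U[0,1] is 1/(j+1)
    momentY : ℕ → Carrier
    momentY j = inv j

    -- E[e_λ^Y(t)] = E[exp(Y · log e_λ(t))] = Σ_j E[Y^j] (log e_λ(t))^j / j!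
    -- ( = (e_λ(t) - 1)/log e_λ(t) )
    EeYS : Carrier → PS
    EeYS lam n = sumTo (suc n) (λ j → momentY j * invFact j * powS (logeS lam) j n)

    deltaYS : Carrier → PS
    deltaYS lam n = EeYS lam n - oneS n

    -- A_{2,n}: t²/2 /(e^t - 1 - t) = 1 / Σ_k B_k t^k/k!  with B_k = 2/((k+1)(k+2)),
    -- so A_{2,0} = 1 and A_{2,n} = - Σ_{k=1}^{n} C(n,k) B_k A_{2,n-k}.
    Bexp : ℕ → Carrier
    Bexp k = fromℕ 2 * inv k * inv (suc k)

    -- accum n i [A_{n-i}, ..., A_0] = Σ_{k=i+1}^{n+1} C(n+1,k) B_k A_{n+1-k}
    accum : ℕ → ℕ → List Carrier → Carrier
    accum n i [] = 0#
    accum n i (a ∷ as) = fromℕ (suc n C suc i) * Bexp (suc i) * a + accum n (suc i) as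

    -- Alist n = [A_{2,n}, A_{2,n-1}, ..., A_{2,0}]
    Alist : ℕ → List Carrier
    Alist zero = 1# ∷ []
    Alist (suc n) = (- accum n 0 (Alist n)) ∷ Alist n

    headOr0 : List Carrier → Carrier
    headOr0 [] = 0#
    headOr0 (a ∷ _) = a

    A2 : ℕ → Carrier
    A2 n = headOr0 (Alist n)

    comps : ℕ → ℕ → List (List ℕ)
    comps zero zero = [] ∷ []
    comps zero (suc m) = []
    comps (suc n) m = concatMap (λ j → map (j ∷_) (comps n (m ∸ j))) (upTo (suc m))

    multinom : ℕ → List ℕ → Carrier
    multinom m js = fromℕ (m !) * prodL (map invFact js)

    innerSum : ℕ → ℕ → Carrier
    innerSum n m = sumL (map (λ js → multinom m js * prodL (map A2 js)) (comps n m))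

    -- the n-th coefficient (w.r.t. t^n/n!) of the right-hand side, n ≥ 1:
    -- 2^n Σ_{m=0}^{n-1} C(n-1,m) innerSum n m λ^{n-m-1}
    rhsCoeff : Carrier → ℕ → Carrier
    rhsCoeff lam n = fromℕ (2 ℕ.^ n) *
      sumTo n (λ m → fromℕ ((n ∸ 1) C m) * innerSum n m * pw lam (n ∸ m ∸ 1))

    rhsS : Carrier → PS
    rhsS lam zero = 0#
    rhsS lam (suc n) = rhsCoeff lam (suc n) * invFact (suc n)

-- The series E[e_λ^Y(t)] − 1 factors as P(L(t)) with P(x) = (eˣ − 1)/x − 1 and L(t) = log e_λ(t), and
-- L has the compositional inverse E(t) = (e^{λt} − 1)/λ, as comparing derivatives shows: L′·(1 + λt) = 1 and
-- E′ = 1 + λE. So the inverse of E[e_λ^Y(t)] − 1 is h = E ∘ P⁻¹. Writing P = t/Φ with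
-- Φ = t²/(eᵗ − 1 − t) = 2 Σ A_{2,n} tⁿ/n!, Lagrange inversion gives [tⁿ] h′ = [tⁿ] E′ Φⁿ⁺¹; expanding Φⁿ⁺¹
-- multinomially and E′ = e^{λt} yields the stated coefficients, and inverses are unique.
{-# OPTIONS --safe #-}
module Submission where

open import Defs
open import Level using (Level)
open import Data.Nat as ℕ using (ℕ; zero; suc; _≤_; _<_; _≤′_; ≤′-refl; ≤′-step; s≤s; _∸_; _!)
import Data.Nat.Properties as ℕₚ
open import Data.Nat.Combinatorics using (_C_; k![n∸k]!∣n!)
open import Data.Nat.Combinatorics.Specification using (nCk≡n!/k![n-k]!)
open import Data.Nat.DivMod using (_/_; m/n*n≡m)
open import Data.Nat.Induction using (<-rec)
open import Data.List using (List; []; _∷_; _++_; map; concatMap; applyUpTo; upTo)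
import Data.List.Properties as Listₚ
open import Data.Product using (Σ; _×_; _,_; proj₁; proj₂)
open import Relation.Nullary using (¬_; yes; no)
open import Relation.Binary.PropositionalEquality as ≡ using (_≡_)
open import Algebra.Bundles using (CommutativeRing)
import Algebra.Solver.Ring.NaturalCoefficients.Default as NaturalSolver
import Algebra.Properties.CommutativeSemigroup as CommutativeSemigroupProperties

module FiniteSums {c ℓ} (R : CommutativeRing c ℓ) where
  open CommutativeRing R
  open Series R
  open import Relation.Binary.Reasoning.Setoid setoid
  open CommutativeSemigroupProperties +-commutativeSemigroup using () renaming (interchange to +-interchange)

  sumTo-cong-< : ∀ n {f g : ℕ → Carrier} → (∀ k → k < n → f k ≈ g k) → sumTo n f ≈ sumTo n g
  sumTo-cong-< zero    f≈g = refl
  sumTo-cong-< (suc n) f≈g = +-cong (sumTo-cong-< n (λ k k<n → f≈g k (ℕₚ.m<n⇒m<1+n k<n))) (f≈g n (ℕₚ.n<1+n n))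

  sumTo-cong : ∀ n {f g : ℕ → Carrier} → (∀ k → f k ≈ g k) → sumTo n f ≈ sumTo n g
  sumTo-cong n f≈g = sumTo-cong-< n (λ k _ → f≈g k)

  sumTo-zero : ∀ n {f : ℕ → Carrier} → (∀ k → k < n → f k ≈ 0#) → sumTo n f ≈ 0#
  sumTo-zero zero    f≈0 = refl
  sumTo-zero (suc n) f≈0 =
    trans (+-cong (sumTo-zero n (λ k k<n → f≈0 k (ℕₚ.m<n⇒m<1+n k<n))) (f≈0 n (ℕₚ.n<1+n n))) (+-identityʳ 0#)

  sumTo-+ : ∀ n f g → sumTo n (λ k → f k + g k) ≈ sumTo n f + sumTo n g
  sumTo-+ zero    f g = sym (+-identityʳ 0#)
  sumTo-+ (suc n) f g = trans (+-congʳ (sumTo-+ n f g)) (+-interchange _ _ _ _)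

  *-distribˡ-sumTo : ∀ n a f → a * sumTo n f ≈ sumTo n (λ k → a * f k)
  *-distribˡ-sumTo zero    a f = zeroʳ a
  *-distribˡ-sumTo (suc n) a f = trans (distribˡ a _ _) (+-congʳ (*-distribˡ-sumTo n a f))

  *-distribʳ-sumTo : ∀ n a f → sumTo n f * a ≈ sumTo n (λ k → f k * a)
  *-distribʳ-sumTo n a f =
    trans (*-comm _ a) (trans (*-distribˡ-sumTo n a f) (sumTo-cong n (λ k → *-comm a (f k))))

  sumTo-head : ∀ n f → sumTo (suc n) f ≈ f 0 + sumTo n (λ k → f (suc k))
  sumTo-head zero    f = trans (+-identityˡ (f 0)) (sym (+-identityʳ (f 0)))
  sumTo-head (suc n) f = trans (+-congʳ (sumTo-head n f)) (+-assoc _ _ _)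

  sumTo-trailing-zeros : ∀ {n m} f → n ≤ m → (∀ k → n ≤ k → f k ≈ 0#) → sumTo m f ≈ sumTo n f
  sumTo-trailing-zeros {n} f n≤m f≈0 = go (ℕₚ.≤⇒≤′ n≤m)
    where
    go : ∀ {m} → n ≤′ m → sumTo m f ≈ sumTo n f
    go ≤′-refl         = refl
    go (≤′-step {m} p) = trans (+-cong (go p) (f≈0 m (ℕₚ.≤′⇒≤ p))) (+-identityʳ _)

  -- conv n F = Σ_{i+j=n} F i j
  conv : ℕ → (ℕ → ℕ → Carrier) → Carrier
  conv zero    F = F 0 0
  conv (suc n) F = F 0 (suc n) + conv n (λ i j → F (suc i) j)

  conv-cong-+ : ∀ n {F G : ℕ → ℕ → Carrier} → (∀ i j → i ℕ.+ j ≡ n → F i j ≈ G i j) → conv n F ≈ conv n G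
  conv-cong-+ zero    F≈G = F≈G 0 0 ≡.refl
  conv-cong-+ (suc n) F≈G = +-cong (F≈G 0 (suc n) ≡.refl) (conv-cong-+ n (λ i j e → F≈G (suc i) j (≡.cong suc e)))

  conv-cong : ∀ n {F G : ℕ → ℕ → Carrier} → (∀ i j → F i j ≈ G i j) → conv n F ≈ conv n G
  conv-cong n F≈G = conv-cong-+ n (λ i j _ → F≈G i j)

  conv-zero : ∀ n {F : ℕ → ℕ → Carrier} → (∀ i j → i ℕ.+ j ≡ n → F i j ≈ 0#) → conv n F ≈ 0#
  conv-zero zero    F≈0 = F≈0 0 0 ≡.refl
  conv-zero (suc n) F≈0 =
    trans (+-cong (F≈0 0 (suc n) ≡.refl) (conv-zero n (λ i j e → F≈0 (suc i) j (≡.cong suc e)))) (+-identityʳ 0#)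

  conv-first : ∀ n F → (∀ i j → suc i ℕ.+ j ≡ n → F (suc i) j ≈ 0#) → conv n F ≈ F 0 n
  conv-first zero    F _   = refl
  conv-first (suc n) F F≈0 = trans (+-congˡ (conv-zero n (λ i j e → F≈0 i j (≡.cong suc e)))) (+-identityʳ _)

  conv-last : ∀ n F → conv (suc n) F ≈ conv n (λ i j → F i (suc j)) + F (suc n) 0
  conv-last zero    F = refl
  conv-last (suc n) F = trans (+-congˡ (conv-last n (λ i j → F (suc i) j))) (sym (+-assoc _ _ _))

  conv-comm : ∀ n F → conv n F ≈ conv n (λ i j → F j i)
  conv-comm zero    F = refl
  conv-comm (suc n) F =
    trans (+-congˡ (conv-comm n _)) (trans (+-comm _ _) (sym (conv-last n (λ i j → F j i))))

  conv-+ : ∀ n F G → conv n (λ i j → F i j + G i j) ≈ conv n F + conv n G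
  conv-+ zero    F G = refl
  conv-+ (suc n) F G = trans (+-congˡ (conv-+ n _ _)) (+-interchange _ _ _ _)

  *-distribˡ-conv : ∀ n a F → a * conv n F ≈ conv n (λ i j → a * F i j)
  *-distribˡ-conv zero    a F = refl
  *-distribˡ-conv (suc n) a F = trans (distribˡ a _ _) (+-congˡ (*-distribˡ-conv n a _))

  *-distribʳ-conv : ∀ n a F → conv n F * a ≈ conv n (λ i j → F i j * a)
  *-distribʳ-conv n a F =
    trans (*-comm _ a) (trans (*-distribˡ-conv n a F) (conv-cong n (λ i j → *-comm a _)))

  conv-sumTo : ∀ n N (G : ℕ → ℕ → ℕ → Carrier) →
               conv n (λ i j → sumTo N (λ k → G k i j)) ≈ sumTo N (λ k → conv n (G k))
  conv-sumTo n zero    G = conv-zero n (λ _ _ _ → refl)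
  conv-sumTo n (suc N) G = trans (conv-+ n _ _) (+-congʳ (conv-sumTo n N G))

  conv-assoc : ∀ n (T : ℕ → ℕ → ℕ → Carrier) →
               conv n (λ i j → conv j (T i)) ≈ conv n (λ m k → conv m (λ i a → T i a k))
  conv-assoc zero    T = refl
  conv-assoc (suc n) T = begin
    (T 0 0 (suc n) + conv n (λ a b → T 0 (suc a) b)) + conv n (λ i j → conv j (T (suc i)))
      ≈⟨ +-congˡ (conv-assoc n (λ i → T (suc i))) ⟩
    (T 0 0 (suc n) + conv n (λ a b → T 0 (suc a) b)) + conv n (λ m k → conv m (λ i a → T (suc i) a k))
      ≈⟨ +-assoc _ _ _ ⟩
    T 0 0 (suc n) + (conv n (λ a b → T 0 (suc a) b) + conv n (λ m k → conv m (λ i a → T (suc i) a k)))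
      ≈⟨ +-congˡ (sym (conv-+ n _ _)) ⟩
    T 0 0 (suc n) + conv n (λ m k → T 0 (suc m) k + conv m (λ i a → T (suc i) a k)) ∎

  sumTo-conv : ∀ n F → sumTo (suc n) (λ k → F k (n ∸ k)) ≈ conv n F
  sumTo-conv zero    F = +-identityˡ _
  sumTo-conv (suc n) F = begin
    sumTo (suc n) (λ k → F k (suc n ∸ k)) + F (suc n) (n ∸ n)
      ≈⟨ +-cong (sumTo-cong-< (suc n) (λ k k≤n → reflexive (≡.cong (F k) (ℕₚ.+-∸-assoc 1 (ℕₚ.≤-pred k≤n)))))
                (reflexive (≡.cong (F (suc n)) (ℕₚ.n∸n≡0 n))) ⟩
    sumTo (suc n) (λ k → F k (suc (n ∸ k))) + F (suc n) 0
      ≈⟨ +-congʳ (sumTo-conv n (λ i j → F i (suc j))) ⟩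
    conv n (λ i j → F i (suc j)) + F (suc n) 0
      ≈⟨ sym (conv-last n F) ⟩
    conv (suc n) F ∎

module ListSums {c ℓ} (R : CommutativeRing c ℓ) where
  open CommutativeRing R
  open Series R
  open FiniteSums R
  open CommutativeSemigroupProperties *-commutativeSemigroup using () renaming (interchange to *-interchange)

  sumL-++ : ∀ xs ys → sumL (xs ++ ys) ≈ sumL xs + sumL ys
  sumL-++ []       ys = sym (+-identityˡ _)
  sumL-++ (x ∷ xs) ys = trans (+-congˡ (sumL-++ xs ys)) (sym (+-assoc _ _ _))

  sumL-map-cong : ∀ {A : Set} {f g : A → Carrier} xs → (∀ x → f x ≈ g x) → sumL (map f xs) ≈ sumL (map g xs)
  sumL-map-cong []       f≈g = refl
  sumL-map-cong (x ∷ xs) f≈g = +-cong (f≈g x) (sumL-map-cong xs f≈g)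

  *-distribˡ-sumL-map : ∀ {A : Set} a (f : A → Carrier) xs → a * sumL (map f xs) ≈ sumL (map (λ x → a * f x) xs)
  *-distribˡ-sumL-map a f []       = zeroʳ a
  *-distribˡ-sumL-map a f (x ∷ xs) = trans (distribˡ _ _ _) (+-congˡ (*-distribˡ-sumL-map a f xs))

  prodL-map-* : ∀ {A : Set} (f g : A → Carrier) xs →
                prodL (map (λ x → f x * g x) xs) ≈ prodL (map f xs) * prodL (map g xs)
  prodL-map-* f g []       = sym (*-identityʳ 1#)
  prodL-map-* f g (x ∷ xs) = trans (*-congˡ (prodL-map-* f g xs)) (*-interchange _ _ _ _)

  sumL-map-concatMap : ∀ {A B : Set} (h : B → Carrier) (f : A → List B) xs →
                       sumL (map h (concatMap f xs)) ≈ sumL (map (λ x → sumL (map h (f x))) xs)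
  sumL-map-concatMap h f []       = refl
  sumL-map-concatMap h f (x ∷ xs) =
    trans (reflexive (≡.cong sumL (Listₚ.map-++ h (f x) (concatMap f xs))))
          (trans (sumL-++ (map h (f x)) _) (+-congˡ (sumL-map-concatMap h f xs)))

  sumL-map-applyUpTo : ∀ (g : ℕ → Carrier) f n → sumL (map g (applyUpTo f n)) ≈ sumTo n (λ k → g (f k))
  sumL-map-applyUpTo g f zero    = refl
  sumL-map-applyUpTo g f (suc n) = trans (+-congˡ (sumL-map-applyUpTo g (λ k → f (suc k)) n)) (sym (sumTo-head n _))

module NumeralsAndPowers {c ℓ} (R : CommutativeRing c ℓ) where
  open CommutativeRing R
  open Series R
  open CommutativeSemigroupProperties *-commutativeSemigroup using () renaming (interchange to *-interchange)

  fromℕ-+ : ∀ m n → fromℕ (m ℕ.+ n) ≈ fromℕ m + fromℕ n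
  fromℕ-+ zero    n = sym (+-identityˡ _)
  fromℕ-+ (suc m) n = trans (+-congˡ (fromℕ-+ m n)) (sym (+-assoc _ _ _))

  fromℕ-* : ∀ m n → fromℕ (m ℕ.* n) ≈ fromℕ m * fromℕ n
  fromℕ-* zero    n = sym (zeroˡ _)
  fromℕ-* (suc m) n =
    trans (fromℕ-+ n (m ℕ.* n)) (trans (+-cong (sym (*-identityˡ _)) (fromℕ-* m n)) (sym (distribʳ _ _ _)))

  pw-cong : ∀ {a b} → a ≈ b → ∀ n → pw a n ≈ pw b n
  pw-cong a≈b zero    = refl
  pw-cong a≈b (suc n) = *-cong a≈b (pw-cong a≈b n)

  pw-1 : ∀ n → pw 1# n ≈ 1#
  pw-1 zero    = refl
  pw-1 (suc n) = trans (*-identityˡ _) (pw-1 n)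

  pw-distrib-* : ∀ a b n → pw (a * b) n ≈ pw a n * pw b n
  pw-distrib-* a b zero    = sym (*-identityʳ 1#)
  pw-distrib-* a b (suc n) = trans (*-congˡ (pw-distrib-* a b n)) (*-interchange a b _ _)

  fromℕ-^ : ∀ a k → fromℕ (a ℕ.^ k) ≈ pw (fromℕ a) k
  fromℕ-^ a zero    = +-identityʳ 1#
  fromℕ-^ a (suc k) = trans (fromℕ-* a (a ℕ.^ k)) (*-congˡ (fromℕ-^ a k))

module SeriesRing {c ℓ} (R : CommutativeRing c ℓ) where
  open CommutativeRing R
  open Series R
  open FiniteSums R
  open import Relation.Binary.Reasoning.Setoid setoid

  infix 4 _≋_
  infixl 6 _⊕_

  _≋_ : PS → PS → Set ℓ
  f ≋ g = ∀ n → f n ≈ g n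

  _⊕_ : PS → PS → PS
  (f ⊕ g) n = f n + g n

  ⊖_ : PS → PS
  (⊖ f) n = - f n

  zeroS : PS
  zeroS _ = 0#

  ≋-refl : ∀ {f} → f ≋ f
  ≋-refl n = refl

  ≋-sym : ∀ {f g} → f ≋ g → g ≋ f
  ≋-sym f≋g n = sym (f≋g n)

  ≋-trans : ∀ {f g h} → f ≋ g → g ≋ h → f ≋ h
  ≋-trans f≋g g≋h n = trans (f≋g n) (g≋h n)

  mulS-conv : ∀ f g n → mulS f g n ≈ conv n (λ i j → f i * g j)
  mulS-conv f g n = sumTo-conv n (λ i j → f i * g j)

  mulS-cong : ∀ {f f′ g g′} → f ≋ f′ → g ≋ g′ → mulS f g ≋ mulS f′ g′
  mulS-cong f≋f′ g≋g′ n = sumTo-cong (suc n) (λ k → *-cong (f≋f′ k) (g≋g′ _))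

  mulS-congˡ : ∀ f {g g′} → g ≋ g′ → mulS f g ≋ mulS f g′
  mulS-congˡ f = mulS-cong (≋-refl {f})

  mulS-congʳ : ∀ g {f f′} → f ≋ f′ → mulS f g ≋ mulS f′ g
  mulS-congʳ g f≋f′ = mulS-cong f≋f′ (≋-refl {g})

  mulS-comm : ∀ f g → mulS f g ≋ mulS g f
  mulS-comm f g n = begin
    mulS f g n                  ≈⟨ mulS-conv f g n ⟩
    conv n (λ i j → f i * g j)  ≈⟨ conv-comm n _ ⟩
    conv n (λ i j → f j * g i)  ≈⟨ conv-cong n (λ i j → *-comm _ _) ⟩
    conv n (λ i j → g i * f j)  ≈⟨ mulS-conv g f n ⟨
    mulS g f n                  ∎

  mulS-assoc : ∀ f g h → mulS (mulS f g) h ≋ mulS f (mulS g h)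
  mulS-assoc f g h n = begin
    mulS (mulS f g) h n
      ≈⟨ mulS-conv _ _ n ⟩
    conv n (λ m k → mulS f g m * h k)
      ≈⟨ conv-cong n (λ m k → trans (*-congʳ (mulS-conv f g m)) (*-distribʳ-conv m _ _)) ⟩
    conv n (λ m k → conv m (λ i a → f i * g a * h k))
      ≈⟨ conv-assoc n _ ⟨
    conv n (λ i j → conv j (λ a b → f i * g a * h b))
      ≈⟨ conv-cong n (λ i j → trans (conv-cong j (λ a b → *-assoc _ _ _)) (sym (*-distribˡ-conv j _ _))) ⟩
    conv n (λ i j → f i * conv j (λ a b → g a * h b))
      ≈⟨ conv-cong n (λ i j → *-congˡ (sym (mulS-conv g h j))) ⟩
    conv n (λ i j → f i * mulS g h j)
      ≈⟨ mulS-conv _ _ n ⟨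
    mulS f (mulS g h) n ∎

  mulS-distribʳ : ∀ f g h → mulS (f ⊕ g) h ≋ mulS f h ⊕ mulS g h
  mulS-distribʳ f g h n = trans (sumTo-cong (suc n) (λ k → distribʳ _ _ _)) (sumTo-+ (suc n) _ _)

  mulS-distribˡ : ∀ f g h → mulS h (f ⊕ g) ≋ mulS h f ⊕ mulS h g
  mulS-distribˡ f g h n = trans (sumTo-cong (suc n) (λ k → distribˡ _ _ _)) (sumTo-+ (suc n) _ _)

  mulS-identityˡ : ∀ f → mulS oneS f ≋ f
  mulS-identityˡ f zero    = trans (mulS-conv oneS f 0) (*-identityˡ _)
  mulS-identityˡ f (suc n) = trans (mulS-conv oneS f (suc n))
    (trans (+-cong (*-identityˡ _) (conv-zero n (λ i j _ → zeroˡ _))) (+-identityʳ _))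

  mulS-identityʳ : ∀ f → mulS f oneS ≋ f
  mulS-identityʳ f = ≋-trans (mulS-comm f oneS) (mulS-identityˡ f)

  mulS-zeroˡ : ∀ f → mulS zeroS f ≋ zeroS
  mulS-zeroˡ f n = sumTo-zero (suc n) (λ k _ → zeroˡ _)

  seriesRing : CommutativeRing c ℓ
  seriesRing = record
    { Carrier = PS
    ; _≈_ = _≋_
    ; _+_ = _⊕_
    ; _*_ = mulS
    ; -_ = ⊖_
    ; 0# = zeroS
    ; 1# = oneS
    ; isCommutativeRing = record
      { isRing = record
        { +-isAbelianGroup = record
          { isGroup = record
            { isMonoid = record
              { isSemigroup = record
                { isMagma = record
                  { isEquivalence = record { refl = ≋-refl ; sym = ≋-sym ; trans = ≋-trans }
                  ; ∙-cong = λ f≋f′ g≋g′ n → +-cong (f≋f′ n) (g≋g′ n) }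
                ; assoc = λ f g h n → +-assoc _ _ _ }
              ; identity = (λ f n → +-identityˡ _) , (λ f n → +-identityʳ _) }
            ; inverse = (λ f n → -‿inverseˡ _) , (λ f n → -‿inverseʳ _)
            ; ⁻¹-cong = λ f≋g n → -‿cong (f≋g n) }
          ; comm = λ f g n → +-comm _ _ }
        ; *-cong = mulS-cong
        ; *-assoc = mulS-assoc
        ; *-identity = mulS-identityˡ , mulS-identityʳ
        ; distrib = (λ h f g → mulS-distribˡ f g h) , (λ h f g → mulS-distribʳ f g h) }
      ; *-comm = mulS-comm } }

  module SeriesSolver = NaturalSolver (CommutativeRing.commutativeSemiring seriesRing)
  open CommutativeSemigroupProperties (CommutativeRing.*-commutativeSemigroup seriesRing)
    using () renaming (interchange to mulS-interchange)

  constS : Carrier → PS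
  constS a zero    = a
  constS a (suc n) = 0#

  shiftS : PS → PS
  shiftS f k = f (suc k)

  constS-cong : ∀ {a b} → a ≈ b → constS a ≋ constS b
  constS-cong a≈b zero    = a≈b
  constS-cong a≈b (suc n) = refl

  constS-* : ∀ a f n → mulS (constS a) f n ≈ a * f n
  constS-* a f zero    = mulS-conv (constS a) f 0
  constS-* a f (suc n) = trans (mulS-conv (constS a) f (suc n))
    (trans (+-congˡ (conv-zero n (λ i j _ → zeroˡ _))) (+-identityʳ _))

  constS-*-constS : ∀ a b → mulS (constS a) (constS b) ≋ constS (a * b)
  constS-*-constS a b zero    = constS-* a (constS b) 0
  constS-*-constS a b (suc n) = trans (constS-* a (constS b) (suc n)) (zeroʳ a)

  constS-+ : ∀ a b → constS (a + b) ≋ constS a ⊕ constS b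
  constS-+ a b zero    = refl
  constS-+ a b (suc n) = sym (+-identityʳ 0#)

  constS-1 : constS 1# ≋ oneS
  constS-1 zero    = refl
  constS-1 (suc n) = refl

  *-oneS : ∀ a n → a * oneS n ≈ constS a n
  *-oneS a zero    = *-identityʳ a
  *-oneS a (suc n) = zeroʳ a

  mulS-at-0 : ∀ f g → mulS f g 0 ≈ f 0 * g 0
  mulS-at-0 f g = mulS-conv f g 0

  tS-*-at-0 : ∀ f → mulS tS f 0 ≈ 0#
  tS-*-at-0 f = trans (mulS-at-0 tS f) (zeroˡ _)

  tS-*-at-suc : ∀ f n → mulS tS f (suc n) ≈ f n
  tS-*-at-suc f n = begin
    mulS tS f (suc n)
      ≈⟨ mulS-conv tS f (suc n) ⟩
    tS 0 * f (suc n) + conv n (λ i j → tS (suc i) * f j)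
      ≈⟨ +-cong (zeroˡ _) (conv-first n _ (λ _ _ _ → zeroˡ _)) ⟩
    0# + 1# * f n
      ≈⟨ trans (+-identityˡ _) (*-identityˡ _) ⟩
    f n ∎

  constS⊕tS*shiftS : ∀ f → f ≋ constS (f 0) ⊕ mulS tS (shiftS f)
  constS⊕tS*shiftS f zero    = sym (trans (+-congˡ (tS-*-at-0 (shiftS f))) (+-identityʳ _))
  constS⊕tS*shiftS f (suc n) = sym (trans (+-congˡ (tS-*-at-suc (shiftS f) n)) (+-identityˡ _))

  shiftS-mulS : ∀ f g → shiftS (mulS f g) ≋ mulS (constS (f 0)) (shiftS g) ⊕ mulS (shiftS f) g
  shiftS-mulS f g k = begin
    mulS f g (suc k)                                    ≈⟨ mulS-conv f g (suc k) ⟩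
    f 0 * g (suc k) + conv k (λ i j → f (suc i) * g j)  ≈⟨ +-cong (constS-* (f 0) (shiftS g) k)
                                                                   (mulS-conv (shiftS f) g k) ⟨
    mulS (constS (f 0)) (shiftS g) k + mulS (shiftS f) g k ∎

  private
    <-of-suc-+ : ∀ i j n → suc i ℕ.+ j ≡ n → j < n
    <-of-suc-+ i j n e = ≡.subst (j <_) e (s≤s (ℕₚ.m≤n+m j i))

  mulS-cong-< : ∀ {g} → g 0 ≈ 0# → ∀ n {Y Y′} → (∀ m → m < n → Y m ≈ Y′ m) → mulS g Y n ≈ mulS g Y′ n
  mulS-cong-< {g} g0≈0 n {Y} {Y′} Y≈Y′ =
    trans (mulS-conv g Y n) (trans (conv-cong-+ n termwise) (sym (mulS-conv g Y′ n)))
    where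
    termwise : ∀ i j → i ℕ.+ j ≡ n → g i * Y j ≈ g i * Y′ j
    termwise zero    j _ = trans (*-congʳ g0≈0) (trans (zeroˡ _) (sym (trans (*-congʳ g0≈0) (zeroˡ _))))
    termwise (suc i) j e = *-congˡ (Y≈Y′ j (<-of-suc-+ i j n e))

  powS-cong : ∀ {g g′} → g ≋ g′ → ∀ j → powS g j ≋ powS g′ j
  powS-cong g≋g′ zero    = ≋-refl
  powS-cong g≋g′ (suc j) = mulS-cong g≋g′ (powS-cong g≋g′ j)

  powS-vanishes-below : ∀ {g} → g 0 ≈ 0# → ∀ j n → n < j → powS g j n ≈ 0#
  powS-vanishes-below {g} g0≈0 (suc j) n n<1+j = trans (mulS-conv g (powS g j) n) (conv-zero n termwise)
    where
    termwise : ∀ a b → a ℕ.+ b ≡ n → g a * powS g j b ≈ 0#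
    termwise zero    b _ = trans (*-congʳ g0≈0) (zeroˡ _)
    termwise (suc a) b e = trans (*-congˡ (powS-vanishes-below g0≈0 j b b<j)) (zeroʳ _)
      where
      b<j : b < j
      b<j = ℕₚ.<-≤-trans (<-of-suc-+ a b n e) (ℕₚ.≤-pred n<1+j)

  powS-diagonal : ∀ {g} → g 0 ≈ 0# → ∀ n → powS g n n ≈ pw (g 1) n
  powS-diagonal g0≈0 zero    = refl
  powS-diagonal {g} g0≈0 (suc n) = begin
    mulS g (powS g n) (suc n)
      ≈⟨ mulS-conv g _ (suc n) ⟩
    g 0 * powS g n (suc n) + conv n (λ a b → g (suc a) * powS g n b)
      ≈⟨ +-cong (trans (*-congʳ g0≈0) (zeroˡ _)) (conv-first n _ higher-terms) ⟩
    0# + g 1 * powS g n n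
      ≈⟨ trans (+-identityˡ _) (*-congˡ (powS-diagonal g0≈0 n)) ⟩
    pw (g 1) (suc n) ∎
    where
    higher-terms : ∀ i j → suc i ℕ.+ j ≡ n → g (suc (suc i)) * powS g n j ≈ 0#
    higher-terms i j e = trans (*-congˡ (powS-vanishes-below g0≈0 n j (<-of-suc-+ i j n e))) (zeroʳ _)

  powS-distrib-mulS : ∀ f g k → powS (mulS f g) k ≋ mulS (powS f k) (powS g k)
  powS-distrib-mulS f g zero    = ≋-sym (mulS-identityˡ oneS)
  powS-distrib-mulS f g (suc k) =
    ≋-trans (mulS-congˡ (mulS f g) (powS-distrib-mulS f g k)) (mulS-interchange f g (powS f k) (powS g k))

  powS-+ : ∀ f a b → powS f (a ℕ.+ b) ≋ mulS (powS f a) (powS f b)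
  powS-+ f zero    b = ≋-sym (mulS-identityˡ _)
  powS-+ f (suc a) b = ≋-trans (mulS-congˡ f (powS-+ f a b)) (≋-sym (mulS-assoc f (powS f a) (powS f b)))

  powS-oneS : ∀ k → powS oneS k ≋ oneS
  powS-oneS zero    = ≋-refl
  powS-oneS (suc k) = ≋-trans (mulS-identityˡ _) (powS-oneS k)

  powS-constS : ∀ a k → powS (constS a) k ≋ constS (pw a k)
  powS-constS a zero    = ≋-sym constS-1
  powS-constS a (suc k) = ≋-trans (mulS-congˡ (constS a) (powS-constS a k)) (constS-*-constS a (pw a k))

  powS-tS-* : ∀ k Y m → mulS (powS tS k) Y (k ℕ.+ m) ≈ Y m
  powS-tS-* zero    Y m = mulS-identityˡ Y m
  powS-tS-* (suc k) Y m =
    trans (mulS-assoc tS (powS tS k) Y (suc (k ℕ.+ m)))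
          (trans (tS-*-at-suc (mulS (powS tS k) Y) (k ℕ.+ m)) (powS-tS-* k Y m))

module Composition {c ℓ} (R : CommutativeRing c ℓ) where
  open CommutativeRing R
  open Series R
  open FiniteSums R
  open NumeralsAndPowers R
  open SeriesRing R
  open SeriesSolver using (solve) renaming (_:+_ to _⊞_; _:*_ to _⊠_; _:=_ to _≐_)
  open import Relation.Binary.Reasoning.Setoid setoid

  compS-cong : ∀ {f f′ g g′} → f ≋ f′ → g ≋ g′ → compS f g ≋ compS f′ g′
  compS-cong f≋f′ g≋g′ n = sumTo-cong (suc n) (λ j → *-cong (f≋f′ j) (powS-cong g≋g′ j n))

  compS-congˡ : ∀ f {g g′} → g ≋ g′ → compS f g ≋ compS f g′
  compS-congˡ f = compS-cong (≋-refl {f})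

  compS-congʳ : ∀ g {f f′} → f ≋ f′ → compS f g ≋ compS f′ g
  compS-congʳ g f≋f′ = compS-cong f≋f′ (≋-refl {g})

  compS-at-0 : ∀ {f g} → f 0 ≈ 0# → compS f g 0 ≈ 0#
  compS-at-0 f0≈0 = trans (+-identityˡ _) (trans (*-congʳ f0≈0) (zeroˡ _))

  compS-distrib-⊕ : ∀ f h g → compS (f ⊕ h) g ≋ compS f g ⊕ compS h g
  compS-distrib-⊕ f h g n = trans (sumTo-cong (suc n) (λ j → distribʳ _ _ _)) (sumTo-+ (suc n) _ _)

  compS-constS-* : ∀ a f g → compS (mulS (constS a) f) g ≋ mulS (constS a) (compS f g)
  compS-constS-* a f g n = begin
    compS (mulS (constS a) f) g n
      ≈⟨ sumTo-cong (suc n) (λ j → trans (*-congʳ (constS-* a f j)) (*-assoc _ _ _)) ⟩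
    sumTo (suc n) (λ j → a * (f j * powS g j n))
      ≈⟨ *-distribˡ-sumTo (suc n) a _ ⟨
    a * compS f g n
      ≈⟨ constS-* a (compS f g) n ⟨
    mulS (constS a) (compS f g) n ∎

  compS-constS : ∀ a g → compS (constS a) g ≋ constS a
  compS-constS a g n = trans (sumTo-head n _)
    (trans (+-cong (*-oneS a n) (sumTo-zero n (λ k _ → zeroˡ _))) (+-identityʳ _))

  compS-oneS : ∀ g → compS oneS g ≋ oneS
  compS-oneS g = ≋-trans (compS-congʳ g (≋-sym constS-1)) (≋-trans (compS-constS 1# g) constS-1)

  compS-identityˡ : ∀ {g} → g 0 ≈ 0# → compS tS g ≋ g
  compS-identityˡ g0≈0 zero    = trans (+-identityˡ _) (trans (zeroˡ _) (sym g0≈0))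
  compS-identityˡ {g} g0≈0 (suc n) = begin
    compS tS g (suc n)
      ≈⟨ trans (sumTo-head (suc n) _) (+-congˡ (sumTo-head n _)) ⟩
    tS 0 * oneS (suc n) + (1# * mulS g oneS (suc n) + sumTo n (λ j → 0# * powS g (suc (suc j)) (suc n)))
      ≈⟨ +-cong (zeroˡ _) (+-cong (trans (*-identityˡ _) (mulS-identityʳ g (suc n))) (sumTo-zero n (λ _ _ → zeroˡ _))) ⟩
    0# + (g (suc n) + 0#)
      ≈⟨ trans (+-identityˡ _) (+-identityʳ _) ⟩
    g (suc n) ∎

  powS-tS-above : ∀ {j n} → j < n → powS tS j n ≈ 0#
  powS-tS-above {j} j<n with ℕₚ.m≤n⇒∃[o]m+o≡n j<n
  ... | d , ≡.refl = ≡.subst (λ n → powS tS j n ≈ 0#) (ℕₚ.+-suc j d)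
                       (trans (sym (mulS-identityʳ (powS tS j) (j ℕ.+ suc d))) (powS-tS-* j oneS (suc d)))

  compS-identityʳ : ∀ f → compS f tS ≋ f
  compS-identityʳ f n = begin
    sumTo n (λ j → f j * powS tS j n) + f n * powS tS n n
      ≈⟨ +-cong (sumTo-zero n (λ j j<n → trans (*-congˡ (powS-tS-above j<n)) (zeroʳ _)))
                (*-congˡ (trans (powS-diagonal refl n) (pw-1 n))) ⟩
    0# + f n * 1#
      ≈⟨ trans (+-identityˡ _) (*-identityʳ _) ⟩
    f n ∎

  compS-as-sumTo : ∀ {g} → g 0 ≈ 0# → ∀ f {n N} → n < N → compS f g n ≈ sumTo N (λ j → f j * powS g j n)
  compS-as-sumTo g0≈0 f n<N =
    sym (sumTo-trailing-zeros _ n<N (λ k n<k → trans (*-congˡ (powS-vanishes-below g0≈0 k _ n<k)) (zeroʳ _)))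

  mulS-compS-expand : ∀ {g} → g 0 ≈ 0# → ∀ f M n →
                      mulS (compS f g) M n ≈ sumTo (suc n) (λ k → f k * mulS (powS g k) M n)
  mulS-compS-expand {g} g0≈0 f M n = begin
    mulS (compS f g) M n
      ≈⟨ mulS-conv _ M n ⟩
    conv n (λ p q → compS f g p * M q)
      ≈⟨ conv-cong-+ n (λ p q e → *-congʳ (compS-as-sumTo g0≈0 f (s≤s (≡.subst (p ≤_) e (ℕₚ.m≤m+n p q))))) ⟩
    conv n (λ p q → sumTo (suc n) (λ k → f k * powS g k p) * M q)
      ≈⟨ conv-cong n (λ p q → *-distribʳ-sumTo (suc n) _ _) ⟩
    conv n (λ p q → sumTo (suc n) (λ k → f k * powS g k p * M q))
      ≈⟨ conv-sumTo n (suc n) _ ⟩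
    sumTo (suc n) (λ k → conv n (λ p q → f k * powS g k p * M q))
      ≈⟨ sumTo-cong (suc n) (λ k → trans (conv-cong n (λ p q → *-assoc _ _ _)) (sym (*-distribˡ-conv n _ _))) ⟩
    sumTo (suc n) (λ k → f k * conv n (λ p q → powS g k p * M q))
      ≈⟨ sumTo-cong (suc n) (λ k → *-congˡ (mulS-conv _ M n)) ⟨
    sumTo (suc n) (λ k → f k * mulS (powS g k) M n) ∎

  compS-unfold : ∀ {g} → g 0 ≈ 0# → ∀ f → compS f g ≋ constS (f 0) ⊕ mulS g (compS (shiftS f) g)
  compS-unfold {g} g0≈0 f n = begin
    compS f g n
      ≈⟨ sumTo-head n _ ⟩
    f 0 * oneS n + sumTo n (λ j → f (suc j) * powS g (suc j) n)
      ≈⟨ +-cong (*-oneS (f 0) n) (sym (sumTo-trailing-zeros _ (ℕₚ.n≤1+n n) top-term-vanishes)) ⟩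
    constS (f 0) n + sumTo (suc n) (λ j → f (suc j) * powS g (suc j) n)
      ≈⟨ +-congˡ (sumTo-cong (suc n) (λ j → *-congˡ (mulS-comm g (powS g j) n))) ⟩
    constS (f 0) n + sumTo (suc n) (λ j → shiftS f j * mulS (powS g j) g n)
      ≈⟨ +-congˡ (mulS-compS-expand g0≈0 (shiftS f) g n) ⟨
    constS (f 0) n + mulS (compS (shiftS f) g) g n
      ≈⟨ +-congˡ (mulS-comm _ g n) ⟩
    constS (f 0) n + mulS g (compS (shiftS f) g) n ∎
    where
    top-term-vanishes : ∀ k → n ≤ k → f (suc k) * powS g (suc k) n ≈ 0#
    top-term-vanishes k n≤k = trans (*-congˡ (powS-vanishes-below g0≈0 (suc k) n (s≤s n≤k))) (zeroʳ _)

  compS-mulS : ∀ {g} → g 0 ≈ 0# → ∀ f h → compS (mulS f h) g ≋ mulS (compS f g) (compS h g)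
  compS-mulS {g} g0≈0 f h n = <-rec Goal step n f h
    where
    Goal : ℕ → Set (c Level.⊔ ℓ)
    Goal n = ∀ f h → compS (mulS f h) g n ≈ mulS (compS f g) (compS h g) n

    step : ∀ n → (∀ {m} → m < n → Goal m) → Goal n
    step n ih f h = begin
      compS (mulS f h) g n
        ≈⟨ compS-unfold g0≈0 (mulS f h) n ⟩
      constS (mulS f h 0) n + mulS g (compS (shiftS (mulS f h)) g) n
        ≈⟨ +-cong (constS-cong (mulS-at-0 f h) n) (mulS-cong-< g0≈0 n shifted) ⟩
      constS (f 0 * h 0) n + mulS g (mulS a H′ ⊕ mulS F′ H) n
        ≈⟨ +-congʳ (constS-*-constS (f 0) (h 0) n) ⟨
      (mulS a b ⊕ mulS g (mulS a H′ ⊕ mulS F′ H)) n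
        ≈⟨ solve 6 (λ a b g H′ F′ H → a ⊠ b ⊞ g ⊠ (a ⊠ H′ ⊞ F′ ⊠ H) ≐ a ⊠ (b ⊞ g ⊠ H′) ⊞ (g ⊠ F′) ⊠ H)
                 ≋-refl a b g H′ F′ H n ⟩
      (mulS a (b ⊕ mulS g H′) ⊕ mulS (mulS g F′) H) n
        ≈⟨ +-congʳ (mulS-congˡ a (compS-unfold g0≈0 h) n) ⟨
      (mulS a H ⊕ mulS (mulS g F′) H) n
        ≈⟨ mulS-distribʳ a (mulS g F′) H n ⟨
      mulS (a ⊕ mulS g F′) H n
        ≈⟨ mulS-congʳ H (compS-unfold g0≈0 f) n ⟨
      mulS (compS f g) H n ∎
      where
      a b F′ H′ H : PS
      a = constS (f 0)
      b = constS (h 0)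
      F′ = compS (shiftS f) g
      H′ = compS (shiftS h) g
      H = compS h g
      shifted : ∀ m → m < n → compS (shiftS (mulS f h)) g m ≈ (mulS a H′ ⊕ mulS F′ H) m
      shifted m m<n = begin
        compS (shiftS (mulS f h)) g m
          ≈⟨ compS-congʳ g (shiftS-mulS f h) m ⟩
        compS (mulS a (shiftS h) ⊕ mulS (shiftS f) h) g m
          ≈⟨ compS-distrib-⊕ _ _ g m ⟩
        compS (mulS a (shiftS h)) g m + compS (mulS (shiftS f) h) g m
          ≈⟨ +-cong (compS-constS-* (f 0) (shiftS h) g m) (ih m<n (shiftS f) h) ⟩
        mulS a H′ m + mulS F′ H m ∎

  compS-assoc : ∀ {h g} → h 0 ≈ 0# → g 0 ≈ 0# → ∀ f → compS (compS f h) g ≋ compS f (compS h g)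
  compS-assoc {h} {g} h0≈0 g0≈0 f n = <-rec Goal step n f
    where
    Goal : ℕ → Set (c Level.⊔ ℓ)
    Goal n = ∀ f → compS (compS f h) g n ≈ compS f (compS h g) n

    hg0≈0 : compS h g 0 ≈ 0#
    hg0≈0 = compS-at-0 {h} {g} h0≈0

    step : ∀ n → (∀ {m} → m < n → Goal m) → Goal n
    step n ih f = begin
      compS (compS f h) g n
        ≈⟨ compS-congʳ g (compS-unfold h0≈0 f) n ⟩
      compS (constS (f 0) ⊕ mulS h (compS (shiftS f) h)) g n
        ≈⟨ compS-distrib-⊕ _ _ g n ⟩
      compS (constS (f 0)) g n + compS (mulS h (compS (shiftS f) h)) g n
        ≈⟨ +-cong (compS-constS (f 0) g n) (compS-mulS g0≈0 h _ n) ⟩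
      constS (f 0) n + mulS (compS h g) (compS (compS (shiftS f) h) g) n
        ≈⟨ +-congˡ (mulS-cong-< hg0≈0 n (λ m m<n → ih m<n (shiftS f))) ⟩
      constS (f 0) n + mulS (compS h g) (compS (shiftS f) (compS h g)) n
        ≈⟨ compS-unfold hg0≈0 f n ⟨
      compS f (compS h g) n ∎

module Derivative {c ℓ} (R : CommutativeRing c ℓ) where
  open CommutativeRing R
  open Series R
  open FiniteSums R
  open NumeralsAndPowers R
  open SeriesRing R
  open Composition R
  open SeriesSolver using (solve) renaming (_:+_ to _⊞_; _:*_ to _⊠_; _:=_ to _≐_)
  open CommutativeSemigroupProperties *-commutativeSemigroup using (x∙yz≈y∙xz)
  open import Relation.Binary.Reasoning.Setoid setoid

  derivS : PS → PS
  derivS f k = fromℕ (suc k) * f (suc k)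

  derivS-cong : ∀ {f f′} → f ≋ f′ → derivS f ≋ derivS f′
  derivS-cong f≋f′ k = *-congˡ (f≋f′ (suc k))

  derivS-⊕ : ∀ f g → derivS (f ⊕ g) ≋ derivS f ⊕ derivS g
  derivS-⊕ f g k = distribˡ _ _ _

  derivS-constS : ∀ a → derivS (constS a) ≋ zeroS
  derivS-constS a k = zeroʳ _

  derivS-oneS : derivS oneS ≋ zeroS
  derivS-oneS = ≋-trans (derivS-cong (≋-sym constS-1)) (derivS-constS 1#)

  derivS-tS : derivS tS ≋ oneS
  derivS-tS zero    = trans (*-identityʳ _) (+-identityʳ _)
  derivS-tS (suc k) = zeroʳ _

  fromℕ-*-conv : ∀ n F → fromℕ n * conv n F ≈ conv n (λ i j → fromℕ i * F i j) + conv n (λ i j → fromℕ j * F i j)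
  fromℕ-*-conv n F = begin
    fromℕ n * conv n F
      ≈⟨ *-distribˡ-conv n _ F ⟩
    conv n (λ i j → fromℕ n * F i j)
      ≈⟨ conv-cong-+ n (λ i j i+j≡n → *-congʳ (trans (reflexive (≡.cong fromℕ (≡.sym i+j≡n))) (fromℕ-+ i j))) ⟩
    conv n (λ i j → (fromℕ i + fromℕ j) * F i j)
      ≈⟨ conv-cong n (λ i j → distribʳ _ _ _) ⟩
    conv n (λ i j → fromℕ i * F i j + fromℕ j * F i j)
      ≈⟨ conv-+ n _ _ ⟩
    conv n (λ i j → fromℕ i * F i j) + conv n (λ i j → fromℕ j * F i j) ∎

  derivS-mulS : ∀ f g → derivS (mulS f g) ≋ mulS (derivS f) g ⊕ mulS f (derivS g)
  derivS-mulS f g k = begin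
    fromℕ (suc k) * mulS f g (suc k)
      ≈⟨ *-congˡ (mulS-conv f g (suc k)) ⟩
    fromℕ (suc k) * conv (suc k) F
      ≈⟨ fromℕ-*-conv (suc k) F ⟩
    conv (suc k) (λ i j → fromℕ i * F i j) + conv (suc k) (λ i j → fromℕ j * F i j)
      ≈⟨ +-congˡ (conv-last k (λ i j → fromℕ j * F i j)) ⟩
    (0# * F 0 (suc k) + conv k (λ i j → fromℕ (suc i) * F (suc i) j))
      + (conv k (λ i j → fromℕ (suc j) * F i (suc j)) + 0# * F (suc k) 0)
      ≈⟨ +-cong (trans (+-congʳ (zeroˡ _)) (+-identityˡ _)) (trans (+-congˡ (zeroˡ _)) (+-identityʳ _)) ⟩
    conv k (λ i j → fromℕ (suc i) * F (suc i) j) + conv k (λ i j → fromℕ (suc j) * F i (suc j))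
      ≈⟨ +-cong (conv-cong k (λ i j → sym (*-assoc _ _ _))) (conv-cong k (λ i j → x∙yz≈y∙xz _ _ _)) ⟩
    conv k (λ i j → derivS f i * g j) + conv k (λ i j → f i * derivS g j)
      ≈⟨ +-cong (mulS-conv (derivS f) g k) (mulS-conv f (derivS g) k) ⟨
    mulS (derivS f) g k + mulS f (derivS g) k ∎
    where
    F : ℕ → ℕ → Carrier
    F i j = f i * g j

  derivS-powS : ∀ f s → derivS (powS f (suc s)) ≋ mulS (constS (fromℕ (suc s))) (mulS (powS f s) (derivS f))
  derivS-powS f zero k = begin
    derivS (mulS f oneS) k              ≈⟨ derivS-cong (mulS-identityʳ f) k ⟩
    derivS f k                          ≈⟨ mulS-identityˡ (derivS f) k ⟨
    mulS oneS (derivS f) k              ≈⟨ trans (*-congʳ (+-identityʳ 1#)) (*-identityˡ _) ⟨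
    (1# + 0#) * mulS oneS (derivS f) k  ≈⟨ constS-* (1# + 0#) (mulS oneS (derivS f)) k ⟨
    mulS (constS (1# + 0#)) (mulS oneS (derivS f)) k ∎
  derivS-powS f (suc s) k = begin
    derivS (mulS f P) k
      ≈⟨ derivS-mulS f P k ⟩
    mulS (derivS f) P k + mulS f (derivS P) k
      ≈⟨ +-congˡ (mulS-congˡ f (derivS-powS f s) k) ⟩
    (mulS (derivS f) (mulS f Pₛ) ⊕ mulS f (mulS s+1 (mulS Pₛ (derivS f)))) k
      ≈⟨ solve 4 (λ f′ f Pₛ k → f′ ⊠ (f ⊠ Pₛ) ⊞ f ⊠ (k ⊠ (Pₛ ⊠ f′)) ≐ (f ⊠ Pₛ) ⊠ f′ ⊞ k ⊠ ((f ⊠ Pₛ) ⊠ f′))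
               ≋-refl (derivS f) f Pₛ s+1 k ⟩
    (X ⊕ mulS s+1 X) k
      ≈⟨ +-congʳ (mulS-identityˡ X k) ⟨
    (mulS oneS X ⊕ mulS s+1 X) k
      ≈⟨ mulS-distribʳ oneS s+1 X k ⟨
    mulS (oneS ⊕ s+1) X k
      ≈⟨ mulS-congʳ X (≋-trans (constS-+ 1# (fromℕ (suc s))) (λ i → +-congʳ (constS-1 i))) k ⟨
    mulS (constS (fromℕ (suc (suc s)))) X k ∎
    where
    P Pₛ s+1 X : PS
    P = powS f (suc s)
    Pₛ = powS f s
    s+1 = constS (fromℕ (suc s))
    X = mulS P (derivS f)

  derivS-shiftS : ∀ f → derivS f ≋ shiftS f ⊕ mulS tS (derivS (shiftS f))
  derivS-shiftS f zero    =
    trans (*-congʳ (+-identityʳ 1#)) (trans (*-identityˡ _) (sym (trans (+-congˡ (tS-*-at-0 (derivS (shiftS f)))) (+-identityʳ _))))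
  derivS-shiftS f (suc k) = trans (distribʳ _ _ _) (+-cong (*-identityˡ _) (sym (tS-*-at-suc (derivS (shiftS f)) k)))

  derivS-compS : ∀ {g} → g 0 ≈ 0# → ∀ f → derivS (compS f g) ≋ mulS (compS (derivS f) g) (derivS g)
  derivS-compS {g} g0≈0 f n = <-rec Goal step n f
    where
    Goal : ℕ → Set (c Level.⊔ ℓ)
    Goal n = ∀ f → derivS (compS f g) n ≈ mulS (compS (derivS f) g) (derivS g) n

    step : ∀ n → (∀ {m} → m < n → Goal m) → Goal n
    step n ih f = begin
      derivS (compS f g) n
        ≈⟨ derivS-cong (compS-unfold g0≈0 f) n ⟩
      derivS (constS (f 0) ⊕ mulS g F′) n
        ≈⟨ derivS-⊕ (constS (f 0)) (mulS g F′) n ⟩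
      derivS (constS (f 0)) n + derivS (mulS g F′) n
        ≈⟨ +-cong (derivS-constS (f 0) n) (derivS-mulS g F′ n) ⟩
      0# + (mulS (derivS g) F′ n + mulS g (derivS F′) n)
        ≈⟨ +-identityˡ _ ⟩
      mulS (derivS g) F′ n + mulS g (derivS F′) n
        ≈⟨ +-congˡ (mulS-cong-< g0≈0 n (λ m m<n → ih m<n (shiftS f))) ⟩
      mulS (derivS g) F′ n + mulS g (mulS Y (derivS g)) n
        ≈⟨ solve 4 (λ g′ F′ g Y → g′ ⊠ F′ ⊞ g ⊠ (Y ⊠ g′) ≐ (F′ ⊞ g ⊠ Y) ⊠ g′) ≋-refl (derivS g) F′ g Y n ⟩
      mulS (F′ ⊕ mulS g Y) (derivS g) n
        ≈⟨ mulS-congʳ (derivS g) f′∘g n ⟨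
      mulS (compS (derivS f) g) (derivS g) n ∎
      where
      F′ Y : PS
      F′ = compS (shiftS f) g
      Y = compS (derivS (shiftS f)) g
      f′∘g : compS (derivS f) g ≋ F′ ⊕ mulS g Y
      f′∘g = ≋-trans (compS-congʳ g (derivS-shiftS f))
             (≋-trans (compS-distrib-⊕ _ _ g)
             (λ k → +-congˡ (trans (compS-mulS g0≈0 tS (derivS (shiftS f)) k)
                                   (mulS-congʳ Y (compS-identityˡ g0≈0) k))))

module CompositionalInverse {c ℓ} (R : CommutativeRing c ℓ) where
  open CommutativeRing R
  open Series R
  open FiniteSums R
  open NumeralsAndPowers R
  open SeriesRing R
  open Composition R
  open CommutativeSemigroupProperties +-commutativeSemigroup using (x∙yz≈y∙xz)
  open CommutativeSemigroupProperties *-commutativeSemigroup using () renaming (xy∙z≈y∙zx to xy*z≈y*zx)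
  open import Relation.Binary.Reasoning.Setoid setoid

  -- Solves f(Q) = t for f coefficient by coefficient: since [tⁿ] Qⁿ = Q₁ⁿ, the n-th equation fixes
  -- fₙ = Q₁⁻ⁿ (tₙ − Σ_{j<n} fⱼ [tⁿ] Qʲ). `prefix n` records f₀, …, fₙ₋₁.
  module LeftInverse (Q : PS) (Q₁⁻¹ : Carrier) where
    nextCoeff : (ℕ → Carrier) → ℕ → Carrier
    nextCoeff f n = pw Q₁⁻¹ n * (tS n - sumTo n (λ j → f j * powS Q j n))

    prefix : ℕ → ℕ → Carrier
    prefix zero    j = 0#
    prefix (suc n) j with j ℕ.≟ n
    ... | yes _ = nextCoeff (prefix n) n
    ... | no  _ = prefix n j

    leftInverse : PS
    leftInverse n = nextCoeff (prefix n) n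

    prefix-stable : ∀ n j → j < n → prefix n j ≈ leftInverse j
    prefix-stable (suc n) j j<1+n with j ℕ.≟ n
    ... | yes ≡.refl = refl
    ... | no  j≢n    = prefix-stable n j (ℕₚ.≤∧≢⇒< (ℕₚ.≤-pred j<1+n) j≢n)

    leftInverse-correct : Q 0 ≈ 0# → Q 1 * Q₁⁻¹ ≈ 1# → compS leftInverse Q ≋ tS
    leftInverse-correct Q0≈0 Q₁*Q₁⁻¹≈1 n = begin
      sumTo n (λ j → leftInverse j * powS Q j n) + leftInverse n * powS Q n n
        ≈⟨ +-cong (sumTo-cong-< n (λ j j<n → *-congʳ (sym (prefix-stable n j j<n))))
                  (*-congˡ (powS-diagonal Q0≈0 n)) ⟩
      S + pw Q₁⁻¹ n * (tS n - S) * pw (Q 1) n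
        ≈⟨ +-congˡ (xy*z≈y*zx _ _ _) ⟩
      S + (tS n - S) * (pw (Q 1) n * pw Q₁⁻¹ n)
        ≈⟨ +-congˡ (*-congˡ (trans (sym (pw-distrib-* _ _ n)) (trans (pw-cong Q₁*Q₁⁻¹≈1 n) (pw-1 n)))) ⟩
      S + (tS n - S) * 1#
        ≈⟨ +-congˡ (*-identityʳ _) ⟩
      S + (tS n - S)
        ≈⟨ x∙yz≈y∙xz S (tS n) (- S) ⟩
      tS n + (S - S)
        ≈⟨ trans (+-congˡ (-‿inverseʳ S)) (+-identityʳ _) ⟩
      tS n ∎
      where
      S : Carrier
      S = sumTo n (λ j → prefix n j * powS Q j n)

  compInverse-at-0 : ∀ {f g} → compS f g ≋ tS → f 0 ≈ 0#
  compInverse-at-0 f∘g≋t = trans (sym (trans (+-identityˡ _) (*-identityʳ _))) (f∘g≋t 0)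

  compInverse-at-1 : ∀ {f g} → compS f g ≋ tS → f 1 * g 1 ≈ 1#
  compInverse-at-1 {f} {g} f∘g≋t = begin
    f 1 * g 1
      ≈⟨ trans (+-congʳ (trans (+-identityˡ _) (zeroʳ _))) (+-identityˡ _) ⟨
    (0# + f 0 * 0#) + f 1 * g 1
      ≈⟨ +-congˡ (*-congˡ (mulS-identityʳ g 1)) ⟨
    compS f g 1
      ≈⟨ f∘g≋t 1 ⟩
    1# ∎

  -- f has a left inverse f⁻¹ since f₁ is a unit, and f⁻¹ = f⁻¹(f(g)) = (f⁻¹(f))(g) = g.
  IsCompInverse-sym : ∀ {f g} → IsCompInverse f g → IsCompInverse g f
  IsCompInverse-sym {f} {g} (g0≈0 , f∘g≋t) = f0≈0 , λ n → begin
    compS g f n       ≈⟨ compS-congʳ f f⁻¹≋g n ⟨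
    compS f⁻¹ f n       ≈⟨ f⁻¹∘f≋t n ⟩
    tS n              ∎
    where
    open LeftInverse f (g 1) renaming (leftInverse to f⁻¹)
    f0≈0 : f 0 ≈ 0#
    f0≈0 = compInverse-at-0 f∘g≋t
    f⁻¹∘f≋t : compS f⁻¹ f ≋ tS
    f⁻¹∘f≋t = leftInverse-correct f0≈0 (compInverse-at-1 f∘g≋t)
    f⁻¹≋g : f⁻¹ ≋ g
    f⁻¹≋g n = begin
      f⁻¹ n                       ≈⟨ compS-identityʳ f⁻¹ n ⟨
      compS f⁻¹ tS n              ≈⟨ compS-congˡ f⁻¹ f∘g≋t n ⟨
      compS f⁻¹ (compS f g) n     ≈⟨ compS-assoc f0≈0 g0≈0 f⁻¹ n ⟨
      compS (compS f⁻¹ f) g n     ≈⟨ compS-congʳ g f⁻¹∘f≋t n ⟩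
      compS tS g n              ≈⟨ compS-identityˡ g0≈0 n ⟩
      g n                       ∎

  IsCompInverse-unique : ∀ {f g h} → IsCompInverse f g → IsCompInverse f h → h ≋ g
  IsCompInverse-unique {f} {g} {h} f∘g≋t@(g0≈0 , _) (h0≈0 , f∘h≋t) n = begin
    h n                       ≈⟨ compS-identityˡ h0≈0 n ⟨
    compS tS h n              ≈⟨ compS-congʳ h g∘f≋t n ⟨
    compS (compS g f) h n     ≈⟨ compS-assoc f0≈0 h0≈0 g n ⟩
    compS g (compS f h) n     ≈⟨ compS-congˡ g f∘h≋t n ⟩
    compS g tS n              ≈⟨ compS-identityʳ g n ⟩
    g n                       ∎
    where
    f0≈0 : f 0 ≈ 0#
    f0≈0 = proj₁ (IsCompInverse-sym f∘g≋t)
    g∘f≋t : compS g f ≋ tS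
    g∘f≋t = proj₂ (IsCompInverse-sym f∘g≋t)

  compInverse-exists : ∀ {Q} (Q₁⁻¹ : Carrier) → Q 0 ≈ 0# → Q 1 * Q₁⁻¹ ≈ 1# → Σ PS (IsCompInverse Q)
  compInverse-exists {Q} Q₁⁻¹ Q0≈0 Q₁*Q₁⁻¹≈1 =
    leftInverse , IsCompInverse-sym (Q0≈0 , leftInverse-correct Q0≈0 Q₁*Q₁⁻¹≈1)
    where
    open LeftInverse Q Q₁⁻¹

[m+n]Cm*[m!*n!]≡[m+n]! : ∀ m n → ((m ℕ.+ n) C m) ℕ.* (m ! ℕ.* n !) ≡ (m ℕ.+ n) !
[m+n]Cm*[m!*n!]≡[m+n]! m n = begin
  ((m ℕ.+ n) C m) ℕ.* (m ! ℕ.* n !)         ≡⟨ ≡.cong (λ k → ((m ℕ.+ n) C m) ℕ.* (m ! ℕ.* k !)) (ℕₚ.m+n∸m≡n m n) ⟨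
  ((m ℕ.+ n) C m) ℕ.* d                     ≡⟨ ≡.cong (ℕ._* d) (nCk≡n!/k![n-k]! m≤m+n) ⟩
  ((m ℕ.+ n) ! / d) ℕ.* d                   ≡⟨ m/n*n≡m (k![n∸k]!∣n! m≤m+n) ⟩
  (m ℕ.+ n) !                               ∎
  where
  open ≡.≡-Reasoning
  m≤m+n : m ≤ m ℕ.+ n
  m≤m+n = ℕₚ.m≤m+n m n
  d : ℕ
  d = m ! ℕ.* (m ℕ.+ n ∸ m) !
  instance
    d≢0 : ℕ.NonZero d
    d≢0 = ℕₚ._!*_!≢0 m (m ℕ.+ n ∸ m)

InvertsSuc : ∀ {c ℓ} (R : CommutativeRing c ℓ) → (ℕ → CommutativeRing.Carrier R) → Set ℓ
InvertsSuc R inv = ∀ n → fromℕ (suc n) * inv n ≈ 1#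
  where
  open CommutativeRing R
  open Series R

module UnitFractions {c ℓ} (R : CommutativeRing c ℓ)
                     (inv : ℕ → CommutativeRing.Carrier R) (inv-correct : InvertsSuc R inv) where
  open CommutativeRing R
  open Series R
  open WithInverses inv
  open NumeralsAndPowers R
  open SeriesRing R
  open Derivative R
  open CommutativeSemigroupProperties *-commutativeSemigroup using () renaming (interchange to *-interchange)
  open import Relation.Binary.Reasoning.Setoid setoid

  inv-correctˡ : ∀ n → inv n * fromℕ (suc n) ≈ 1#
  inv-correctˡ n = trans (*-comm _ _) (inv-correct n)

  inv-0 : inv 0 ≈ 1#
  inv-0 = trans (sym (*-identityˡ _)) (trans (*-congʳ (sym (+-identityʳ 1#))) (inv-correct 0))

  inv-*-fromℕ-* : ∀ n x → inv n * (fromℕ (suc n) * x) ≈ x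
  inv-*-fromℕ-* n x = trans (sym (*-assoc _ _ _)) (trans (*-congʳ (inv-correctˡ n)) (*-identityˡ x))

  fromℕ-suc-cancel : ∀ n {x} → fromℕ (suc n) * x ≈ 0# → x ≈ 0#
  fromℕ-suc-cancel n {x} [n+1]x≈0 = trans (sym (inv-*-fromℕ-* n x)) (trans (*-congˡ [n+1]x≈0) (zeroʳ _))

  derivS-injective : ∀ {f g} → f 0 ≈ g 0 → derivS f ≋ derivS g → f ≋ g
  derivS-injective f0≈g0 f′≋g′ zero    = f0≈g0
  derivS-injective {f} {g} f0≈g0 f′≋g′ (suc k) = begin
    f (suc k)                          ≈⟨ inv-*-fromℕ-* k (f (suc k)) ⟨
    inv k * (fromℕ (suc k) * f (suc k)) ≈⟨ *-congˡ (f′≋g′ k) ⟩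
    inv k * (fromℕ (suc k) * g (suc k)) ≈⟨ inv-*-fromℕ-* k (g (suc k)) ⟩
    g (suc k)                          ∎

  fromℕ-!-*-invFact : ∀ m → fromℕ (m !) * invFact m ≈ 1#
  fromℕ-!-*-invFact zero    = trans (*-congʳ (+-identityʳ 1#)) (*-identityˡ 1#)
  fromℕ-!-*-invFact (suc m) = begin
    fromℕ (suc m ℕ.* m !) * (invFact m * inv m)
      ≈⟨ *-congʳ (fromℕ-* (suc m) (m !)) ⟩
    fromℕ (suc m) * fromℕ (m !) * (invFact m * inv m)
      ≈⟨ *-interchange _ _ _ _ ⟩
    (fromℕ (suc m) * invFact m) * (fromℕ (m !) * inv m)
      ≈⟨ *-congʳ (*-comm _ _) ⟩
    (invFact m * fromℕ (suc m)) * (fromℕ (m !) * inv m)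
      ≈⟨ *-interchange _ _ _ _ ⟩
    (invFact m * fromℕ (m !)) * (fromℕ (suc m) * inv m)
      ≈⟨ *-cong (trans (*-comm _ _) (fromℕ-!-*-invFact m)) (inv-correct m) ⟩
    1# * 1#
      ≈⟨ *-identityʳ 1# ⟩
    1# ∎

  fromℕC-*-invFact : ∀ {n} a b → a ℕ.+ b ≡ n → fromℕ (n C a) * invFact n ≈ invFact a * invFact b
  fromℕC-*-invFact a b ≡.refl = begin
    binom * iₙ
      ≈⟨ trans (*-congˡ (trans (*-cong (fromℕ-!-*-invFact a) (fromℕ-!-*-invFact b)) (*-identityʳ 1#))) (*-identityʳ _) ⟨
    binom * iₙ * ((fromℕ (a !) * iₐ) * (fromℕ (b !) * i_b))
      ≈⟨ solve 6 (λ C iₙ a! iₐ b! i_b → C :* iₙ :* ((a! :* iₐ) :* (b! :* i_b)) := (C :* (a! :* b!)) :* iₙ :* (iₐ :* i_b))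
               refl binom iₙ (fromℕ (a !)) iₐ (fromℕ (b !)) i_b ⟩
    binom * (fromℕ (a !) * fromℕ (b !)) * iₙ * (iₐ * i_b)
      ≈⟨ *-congʳ (*-congʳ factorials) ⟩
    fromℕ ((a ℕ.+ b) !) * iₙ * (iₐ * i_b)
      ≈⟨ trans (*-congʳ (fromℕ-!-*-invFact (a ℕ.+ b))) (*-identityˡ _) ⟩
    iₐ * i_b ∎
    where
    open NaturalSolver commutativeSemiring using (solve; _:*_; _:=_)
    binom iₙ iₐ i_b : Carrier
    binom = fromℕ ((a ℕ.+ b) C a)
    iₙ = invFact (a ℕ.+ b)
    iₐ = invFact a
    i_b = invFact b
    factorials : binom * (fromℕ (a !) * fromℕ (b !)) ≈ fromℕ ((a ℕ.+ b) !)
    factorials = begin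
      binom * (fromℕ (a !) * fromℕ (b !))    ≈⟨ *-congˡ (fromℕ-* (a !) (b !)) ⟨
      binom * fromℕ (a ! ℕ.* b !)            ≈⟨ fromℕ-* ((a ℕ.+ b) C a) (a ! ℕ.* b !) ⟨
      fromℕ (((a ℕ.+ b) C a) ℕ.* (a ! ℕ.* b !)) ≡⟨ ≡.cong fromℕ ([m+n]Cm*[m!*n!]≡[m+n]! a b) ⟩
      fromℕ ((a ℕ.+ b) !)                    ∎

module LagrangeInversion {c ℓ} (R : CommutativeRing c ℓ)
                         (inv : ℕ → CommutativeRing.Carrier R) (inv-correct : InvertsSuc R inv) where
  open CommutativeRing R
  open Series R
  open SeriesRing R
  open FiniteSums R
  open Composition R
  open Derivative R
  open UnitFractions R inv inv-correct
  open SeriesSolver using (solve) renaming (_:+_ to _⊞_; _:*_ to _⊠_; _:=_ to _≐_)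
  open import Relation.Binary.Reasoning.Setoid setoid

  module _ (Q Φ : PS) (Q0≈0 : Q 0 ≈ 0#) (Φ*Q₊≋1 : mulS Φ (shiftS Q) ≋ oneS) where

    Q₊ : PS
    Q₊ = shiftS Q

    -- κ r = [tʳ] Q′ Φʳ⁺¹ is the formal residue of Q′/Qʳ⁺¹ (as Φ = t/Q): 1 for r = 0 and 0 otherwise.
    κ : ℕ → Carrier
    κ r = mulS (derivS Q) (powS Φ (suc r)) r

    Q′*Φʳ⁺¹ : ∀ r → mulS (derivS Q) (powS Φ (suc r)) ≋ powS Φ r ⊕ mulS tS (mulS (derivS Q₊) (powS Φ (suc r)))
    Q′*Φʳ⁺¹ r n = begin
      mulS (derivS Q) (mulS Φ Φʳ) n
        ≈⟨ mulS-congʳ (mulS Φ Φʳ) (derivS-shiftS Q) n ⟩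
      mulS (Q₊ ⊕ mulS tS (derivS Q₊)) (mulS Φ Φʳ) n
        ≈⟨ solve 5 (λ Q₊ t Q₊′ Φ Φʳ → (Q₊ ⊞ t ⊠ Q₊′) ⊠ (Φ ⊠ Φʳ) ≐ (Φ ⊠ Q₊) ⊠ Φʳ ⊞ t ⊠ (Q₊′ ⊠ (Φ ⊠ Φʳ)))
                 ≋-refl Q₊ tS (derivS Q₊) Φ Φʳ n ⟩
      mulS (mulS Φ Q₊) Φʳ n + mulS tS (mulS (derivS Q₊) (mulS Φ Φʳ)) n
        ≈⟨ +-congʳ (trans (mulS-congʳ Φʳ Φ*Q₊≋1 n) (mulS-identityˡ Φʳ n)) ⟩
      Φʳ n + mulS tS (mulS (derivS Q₊) (mulS Φ Φʳ)) n ∎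
      where
      Φʳ : PS
      Φʳ = powS Φ r

    κ-zero : κ 0 ≈ 1#
    κ-zero = trans (Q′*Φʳ⁺¹ 0 0) (trans (+-congˡ (tS-*-at-0 (mulS (derivS Q₊) (powS Φ 1)))) (+-identityʳ 1#))

    Φˢ*Φ′+Q₊′*Φˢ⁺² : ∀ s → mulS (powS Φ s) (derivS Φ) ⊕ mulS (derivS Q₊) (powS Φ (suc (suc s))) ≋ zeroS
    Φˢ*Φ′+Q₊′*Φˢ⁺² s n = begin
      mulS Φˢ (derivS Φ) n + mulS (derivS Q₊) (mulS Φ (mulS Φ Φˢ)) n
        ≈⟨ +-congʳ (trans (mulS-congʳ (mulS Φˢ (derivS Φ)) Φ*Q₊≋1 n) (mulS-identityˡ (mulS Φˢ (derivS Φ)) n)) ⟨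
      mulS (mulS Φ Q₊) (mulS Φˢ (derivS Φ)) n + mulS (derivS Q₊) (mulS Φ (mulS Φ Φˢ)) n
        ≈⟨ solve 5 (λ Φ′ Q₊ Φ Q₊′ Φˢ → (Φ ⊠ Q₊) ⊠ (Φˢ ⊠ Φ′) ⊞ Q₊′ ⊠ (Φ ⊠ (Φ ⊠ Φˢ)) ≐ (Φ′ ⊠ Q₊ ⊞ Φ ⊠ Q₊′) ⊠ (Φ ⊠ Φˢ))
                 ≋-refl (derivS Φ) Q₊ Φ (derivS Q₊) Φˢ n ⟩
      mulS (mulS (derivS Φ) Q₊ ⊕ mulS Φ (derivS Q₊)) (mulS Φ Φˢ) n
        ≈⟨ mulS-congʳ (mulS Φ Φˢ) (derivS-mulS Φ Q₊) n ⟨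
      mulS (derivS (mulS Φ Q₊)) (mulS Φ Φˢ) n
        ≈⟨ mulS-congʳ (mulS Φ Φˢ) (≋-trans (derivS-cong Φ*Q₊≋1) derivS-oneS) n ⟩
      mulS zeroS (mulS Φ Φˢ) n
        ≈⟨ mulS-zeroˡ (mulS Φ Φˢ) n ⟩
      0# ∎
      where
      Φˢ : PS
      Φˢ = powS Φ s

    κ-suc : ∀ s → κ (suc s) ≈ 0#
    κ-suc s = fromℕ-suc-cancel s (begin
      fromℕ (suc s) * κ (suc s)
        ≈⟨ *-congˡ (trans (Q′*Φʳ⁺¹ (suc s) (suc s)) (+-congˡ (tS-*-at-suc (mulS (derivS Q₊) (powS Φ (suc (suc s)))) s))) ⟩
      fromℕ (suc s) * (powS Φ (suc s) (suc s) + B)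
        ≈⟨ distribˡ _ _ _ ⟩
      derivS (powS Φ (suc s)) s + fromℕ (suc s) * B
        ≈⟨ +-congʳ (trans (derivS-powS Φ s s) (constS-* (fromℕ (suc s)) (mulS (powS Φ s) (derivS Φ)) s)) ⟩
      fromℕ (suc s) * mulS (powS Φ s) (derivS Φ) s + fromℕ (suc s) * B
        ≈⟨ distribˡ _ _ _ ⟨
      fromℕ (suc s) * (mulS (powS Φ s) (derivS Φ) s + B)
        ≈⟨ *-congˡ (Φˢ*Φ′+Q₊′*Φˢ⁺² s s) ⟩
      fromℕ (suc s) * 0#
        ≈⟨ zeroʳ _ ⟩
      0# ∎)
      where
      B : Carrier
      B = mulS (derivS Q₊) (powS Φ (suc (suc s))) s

    Q≋t*Q₊ : Q ≋ mulS tS Q₊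
    Q≋t*Q₊ k = trans (constS⊕tS*shiftS Q k) (trans (+-congʳ (constant-term k)) (+-identityˡ _))
      where
      constant-term : ∀ k → constS (Q 0) k ≈ 0#
      constant-term zero    = Q0≈0
      constant-term (suc k) = refl

    Qᵏ≋tᵏ*Q₊ᵏ : ∀ k → powS Q k ≋ mulS (powS tS k) (powS Q₊ k)
    Qᵏ≋tᵏ*Q₊ᵏ k = ≋-trans (powS-cong Q≋t*Q₊ k) (powS-distrib-mulS tS Q₊ k)

    Q₊ᵏ*Φᵏ≋1 : ∀ k → mulS (powS Q₊ k) (powS Φ k) ≋ oneS
    Q₊ᵏ*Φᵏ≋1 k = ≋-trans (≋-sym (powS-distrib-mulS Q₊ Φ k))
                  (≋-trans (powS-cong (≋-trans (mulS-comm Q₊ Φ) Φ*Q₊≋1) k) (powS-oneS k))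

    Qᵏ*Q′*Φ-coeff : ∀ k r → mulS (powS Q k) (mulS (derivS Q) (powS Φ (suc (k ℕ.+ r)))) (k ℕ.+ r) ≈ κ r
    Qᵏ*Q′*Φ-coeff k r = begin
      mulS (powS Q k) (mulS Q′ (powS Φ (suc (k ℕ.+ r)))) (k ℕ.+ r)
        ≡⟨ ≡.cong (λ m → mulS (powS Q k) (mulS Q′ (powS Φ m)) (k ℕ.+ r)) (ℕₚ.+-suc k r) ⟨
      mulS (powS Q k) (mulS Q′ (powS Φ (k ℕ.+ suc r))) (k ℕ.+ r)
        ≈⟨ mulS-cong (Qᵏ≋tᵏ*Q₊ᵏ k) (mulS-congˡ Q′ (powS-+ Φ k (suc r))) (k ℕ.+ r) ⟩
      mulS (mulS (powS tS k) (powS Q₊ k)) (mulS Q′ (mulS (powS Φ k) Φʳ⁺¹)) (k ℕ.+ r)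
        ≈⟨ solve 5 (λ T A D B C → (T ⊠ A) ⊠ (D ⊠ (B ⊠ C)) ≐ T ⊠ ((A ⊠ B) ⊠ (D ⊠ C)))
                 ≋-refl (powS tS k) (powS Q₊ k) Q′ (powS Φ k) Φʳ⁺¹ (k ℕ.+ r) ⟩
      mulS (powS tS k) (mulS (mulS (powS Q₊ k) (powS Φ k)) (mulS Q′ Φʳ⁺¹)) (k ℕ.+ r)
        ≈⟨ mulS-congˡ (powS tS k) (≋-trans (mulS-congʳ (mulS Q′ Φʳ⁺¹) (Q₊ᵏ*Φᵏ≋1 k)) (mulS-identityˡ (mulS Q′ Φʳ⁺¹))) (k ℕ.+ r) ⟩
      mulS (powS tS k) (mulS Q′ Φʳ⁺¹) (k ℕ.+ r)
        ≈⟨ powS-tS-* k (mulS Q′ Φʳ⁺¹) r ⟩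
      κ r ∎
      where
      Q′ Φʳ⁺¹ : PS
      Q′ = derivS Q
      Φʳ⁺¹ = powS Φ (suc r)

    lagrange-inversion : ∀ h n → mulS (derivS (compS h Q)) (powS Φ (suc n)) n ≈ derivS h n
    lagrange-inversion h n = begin
      mulS (derivS (compS h Q)) (powS Φ (suc n)) n
        ≈⟨ mulS-congʳ (powS Φ (suc n)) (derivS-compS Q0≈0 h) n ⟩
      mulS (mulS (compS (derivS h) Q) (derivS Q)) (powS Φ (suc n)) n
        ≈⟨ mulS-assoc (compS (derivS h) Q) (derivS Q) (powS Φ (suc n)) n ⟩
      mulS (compS (derivS h) Q) M n
        ≈⟨ mulS-compS-expand Q0≈0 (derivS h) M n ⟩
      sumTo n (λ k → derivS h k * mulS (powS Q k) M n) + derivS h n * mulS (powS Q n) M n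
        ≈⟨ +-cong (sumTo-zero n (λ k k<n → trans (*-congˡ (lower-term k<n)) (zeroʳ _))) (*-congˡ top-term) ⟩
      0# + derivS h n * 1#
        ≈⟨ trans (+-identityˡ _) (*-identityʳ _) ⟩
      derivS h n ∎
      where
      M : PS
      M = mulS (derivS Q) (powS Φ (suc n))
      coeff : ∀ {k} → k ≤ n → mulS (powS Q k) M n ≈ κ (n ∸ k)
      coeff {k} k≤n = ≡.subst (λ m → mulS (powS Q k) (mulS (derivS Q) (powS Φ (suc m))) m ≈ κ (n ∸ k))
                              (ℕₚ.m+[n∸m]≡n k≤n) (Qᵏ*Q′*Φ-coeff k (n ∸ k))
      lower-term : ∀ {k} → k < n → mulS (powS Q k) M n ≈ 0#
      lower-term {k} k<n = trans (coeff (ℕₚ.<⇒≤ k<n)) (trans (reflexive (≡.cong κ (ℕₚ.+-∸-assoc 1 k<n))) (κ-suc _))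
      top-term : mulS (powS Q n) M n ≈ 1#
      top-term = trans (coeff ℕₚ.≤-refl) (trans (reflexive (≡.cong κ (ℕₚ.n∸n≡0 n))) κ-zero)

module A2Series {c ℓ} (R : CommutativeRing c ℓ)
                (inv : ℕ → CommutativeRing.Carrier R) (inv-correct : InvertsSuc R inv) where
  open CommutativeRing R
  open Series R
  open WithInverses inv
  open FiniteSums R
  open SeriesRing R
  open ListSums R
  open UnitFractions R inv inv-correct
  open NaturalSolver commutativeSemiring using (solve; _:*_; _:=_; con)
  open CommutativeSemigroupProperties *-commutativeSemigroup using () renaming (interchange to *-interchange)
  open import Algebra.Properties.Ring ring using (-‿distribˡ-*)
  open CommutativeSemigroupProperties (CommutativeRing.*-commutativeSemigroup seriesRing) using (xy∙z≈xz∙y)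
  open import Relation.Binary.Reasoning.Setoid setoid

  powS-as-sum-over-comps : ∀ a k m → powS a k m ≈ sumL (map (λ js → prodL (map a js)) (comps k m))
  powS-as-sum-over-comps a zero    zero    = sym (+-identityʳ 1#)
  powS-as-sum-over-comps a zero    (suc m) = refl
  powS-as-sum-over-comps a (suc k) m = begin
    sumTo (suc m) (λ j → a j * powS a k (m ∸ j))
      ≈⟨ sumTo-cong (suc m) (λ j → *-congˡ (powS-as-sum-over-comps a k (m ∸ j))) ⟩
    sumTo (suc m) (λ j → a j * sumΠ (comps k (m ∸ j)))
      ≈⟨ sumL-map-applyUpTo _ (λ j → j) (suc m) ⟨
    sumL (map (λ j → a j * sumΠ (comps k (m ∸ j))) (upTo (suc m)))
      ≈⟨ sumL-map-cong (upTo (suc m)) extend-compositions ⟩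
    sumL (map (λ j → sumΠ (map (j ∷_) (comps k (m ∸ j)))) (upTo (suc m)))
      ≈⟨ sumL-map-concatMap Π (λ j → map (j ∷_) (comps k (m ∸ j))) (upTo (suc m)) ⟨
    sumΠ (comps (suc k) m) ∎
    where
    Π : List ℕ → Carrier
    Π js = prodL (map a js)
    sumΠ : List (List ℕ) → Carrier
    sumΠ jss = sumL (map Π jss)
    extend-compositions : ∀ j → a j * sumΠ (comps k (m ∸ j)) ≈ sumΠ (map (j ∷_) (comps k (m ∸ j)))
    extend-compositions j = trans (*-distribˡ-sumL-map (a j) Π (comps k (m ∸ j)))
                                  (reflexive (≡.cong sumL (Listₚ.map-∘ (comps k (m ∸ j)))))

  A2S : PS
  A2S k = A2 k * invFact k

  powS-A2S : ∀ k m → powS A2S k m ≈ innerSum k m * invFact m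
  powS-A2S k m = begin
    powS A2S k m
      ≈⟨ powS-as-sum-over-comps A2S k m ⟩
    sumL (map (λ js → prodL (map A2S js)) (comps k m))
      ≈⟨ *-identityˡ _ ⟨
    1# * sumL (map (λ js → prodL (map A2S js)) (comps k m))
      ≈⟨ *-congʳ (trans (*-comm _ _) (fromℕ-!-*-invFact m)) ⟨
    invFact m * fromℕ (m !) * sumL (map (λ js → prodL (map A2S js)) (comps k m))
      ≈⟨ *-assoc _ _ _ ⟩
    invFact m * (fromℕ (m !) * sumL (map (λ js → prodL (map A2S js)) (comps k m)))
      ≈⟨ *-congˡ (*-distribˡ-sumL-map (fromℕ (m !)) _ (comps k m)) ⟩
    invFact m * sumL (map (λ js → fromℕ (m !) * prodL (map A2S js)) (comps k m))
      ≈⟨ *-congˡ (sumL-map-cong (comps k m) multinomial-term) ⟨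
    invFact m * innerSum k m
      ≈⟨ *-comm _ _ ⟩
    innerSum k m * invFact m ∎
    where
    multinomial-term : ∀ js → multinom m js * prodL (map A2 js) ≈ fromℕ (m !) * prodL (map A2S js)
    multinomial-term js = trans (*-assoc _ _ _) (*-congˡ (trans (*-comm _ _) (sym (prodL-map-* A2 invFact js))))

  A2-suc : ∀ m → A2 (suc m) ≈ - conv m (λ a b → fromℕ (suc m C suc a) * Bexp (suc a) * A2 b)
  A2-suc m = -‿cong (accum-as-conv 0 m)
    where
    term : ℕ → ℕ → Carrier
    term a b = fromℕ (suc m C suc a) * Bexp (suc a) * A2 b
    accum-as-conv : ∀ i k → accum m i (Alist k) ≈ conv k (λ a b → term (i ℕ.+ a) b)
    accum-as-conv i zero    = trans (+-identityʳ _) (reflexive (≡.cong (λ x → term x 0) (≡.sym (ℕₚ.+-identityʳ i))))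
    accum-as-conv i (suc k) = +-cong (reflexive (≡.cong (λ x → term x (suc k)) (≡.sym (ℕₚ.+-identityʳ i))))
      (trans (accum-as-conv (suc i) k) (conv-cong k (λ a b → reflexive (≡.cong (λ x → term x b) (≡.sym (ℕₚ.+-suc i a))))))

  -- Σₖ Bₖ tᵏ/k! = 2(eᵗ − 1 − t)/t², so that A2S is its reciprocal.
  B2S : PS
  B2S k = Bexp k * invFact k

  B2S-at-0 : B2S 0 ≈ 1#
  B2S-at-0 = begin
    fromℕ 2 * inv 0 * inv 1 * 1#   ≈⟨ solve 3 (λ two i₀ i₁ → two :* i₀ :* i₁ :* con 1 := (two :* i₁) :* i₀) refl _ _ _ ⟩
    (fromℕ 2 * inv 1) * inv 0      ≈⟨ *-cong (inv-correct 1) inv-0 ⟩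
    1# * 1#                        ≈⟨ *-identityʳ 1# ⟩
    1#                             ∎

  B2S*A2S≋1 : mulS B2S A2S ≋ oneS
  B2S*A2S≋1 zero    = trans (mulS-at-0 B2S A2S) (trans (*-cong B2S-at-0 (*-identityʳ 1#)) (*-identityʳ 1#))
  B2S*A2S≋1 (suc m) = begin
    mulS B2S A2S (suc m)
      ≈⟨ mulS-conv B2S A2S (suc m) ⟩
    B2S 0 * (A2 (suc m) * invFact (suc m)) + conv m (λ a b → B2S (suc a) * A2S b)
      ≈⟨ +-cong (*-cong B2S-at-0 (*-congʳ (A2-suc m))) (sym convolution) ⟩
    1# * (- S * invFact (suc m)) + S * invFact (suc m)
      ≈⟨ +-congʳ (trans (*-identityˡ _) (sym (-‿distribˡ-* S _))) ⟩
    - (S * invFact (suc m)) + S * invFact (suc m)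
      ≈⟨ -‿inverseˡ _ ⟩
    0# ∎
    where
    S : Carrier
    S = conv m (λ a b → fromℕ (suc m C suc a) * Bexp (suc a) * A2 b)
    convolution : S * invFact (suc m) ≈ conv m (λ a b → B2S (suc a) * A2S b)
    convolution = begin
      S * invFact (suc m)
        ≈⟨ *-distribʳ-conv m _ _ ⟩
      conv m (λ a b → fromℕ (suc m C suc a) * Bexp (suc a) * A2 b * invFact (suc m))
        ≈⟨ conv-cong-+ m (λ a b a+b≡m → trans (solve 4 (λ C B A i → C :* B :* A :* i := B :* A :* (C :* i)) refl _ _ _ _)
                                              (*-congˡ (fromℕC-*-invFact (suc a) b (≡.cong suc a+b≡m)))) ⟩
      conv m (λ a b → Bexp (suc a) * A2 b * (invFact (suc a) * invFact b))
        ≈⟨ conv-cong m (λ a b → *-interchange _ _ _ _) ⟩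
      conv m (λ a b → B2S (suc a) * A2S b) ∎

  -- P(x) = E[e^{xY}] − 1 = (eˣ − 1)/x − 1, so shiftS P = (eˣ − 1 − x)/x² = B2S/2.
  P : PS
  P zero    = 0#
  P (suc k) = inv (suc k) * invFact (suc k)

  Φ : PS
  Φ = mulS (constS (fromℕ 2)) A2S

  Φ*P₊≋1 : mulS Φ (shiftS P) ≋ oneS
  Φ*P₊≋1 n = begin
    mulS (mulS two A2S) (shiftS P) n      ≈⟨ xy∙z≈xz∙y two A2S (shiftS P) n ⟩
    mulS (mulS two (shiftS P)) A2S n      ≈⟨ mulS-congʳ A2S two*P₊≋B2S n ⟩
    mulS B2S A2S n                        ≈⟨ B2S*A2S≋1 n ⟩
    oneS n                                ∎
    where
    two : PS
    two = constS (fromℕ 2)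
    two*P₊≋B2S : mulS two (shiftS P) ≋ B2S
    two*P₊≋B2S k = trans (constS-* (fromℕ 2) (shiftS P) k)
      (solve 4 (λ two i₊ iF i → two :* (i₊ :* (iF :* i)) := two :* i :* i₊ :* iF) refl (fromℕ 2) (inv (suc k)) (invFact k) (inv k))

  P₁*Φ₀≈1 : P 1 * Φ 0 ≈ 1#
  P₁*Φ₀≈1 = trans (*-comm _ _) (trans (sym (mulS-at-0 Φ (shiftS P))) (Φ*P₊≋1 0))

  powS-Φ : ∀ k j → powS Φ k j ≈ pw (fromℕ 2) k * (innerSum k j * invFact j)
  powS-Φ k j = begin
    powS Φ k j                                   ≈⟨ powS-distrib-mulS (constS (fromℕ 2)) A2S k j ⟩
    mulS (powS (constS (fromℕ 2)) k) (powS A2S k) j ≈⟨ mulS-congʳ (powS A2S k) (powS-constS (fromℕ 2) k) j ⟩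
    mulS (constS (pw (fromℕ 2) k)) (powS A2S k) j ≈⟨ constS-* (pw (fromℕ 2) k) (powS A2S k) j ⟩
    pw (fromℕ 2) k * powS A2S k j                ≈⟨ *-congˡ (powS-A2S k j) ⟩
    pw (fromℕ 2) k * (innerSum k j * invFact j)  ∎

module DegenerateLogarithm {c ℓ} (R : CommutativeRing c ℓ)
                           (inv : ℕ → CommutativeRing.Carrier R) (inv-correct : InvertsSuc R inv)
                           (lam : CommutativeRing.Carrier R) where
  open CommutativeRing R
  open Series R
  open WithInverses inv
  open FiniteSums R
  open SeriesRing R
  open Composition R
  open Derivative R
  open UnitFractions R inv inv-correct
  open A2Series R inv inv-correct using (P)
  open NaturalSolver commutativeSemiring using (solve; _:*_; _:=_)
  open SeriesSolver using () renaming (solve to solveS; _:+_ to _⊞_; _:*_ to _⊠_; _:=_ to _≐_; con to conS)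
  open import Algebra.Properties.AbelianGroup +-abelianGroup using (xyx⁻¹≈y)
  open import Algebra.Properties.Ring ring using (-1*x≈-x)
  open import Relation.Binary.Reasoning.Setoid setoid

  L : PS
  L = logeS lam

  -- E(t) = (e^{λt} − 1)/λ, the compositional inverse of L.
  E : PS
  E zero    = 0#
  E (suc k) = pw lam k * invFact (suc k)

  1+λt : PS
  1+λt = oneS ⊕ mulS (constS lam) tS

  deltaYS≋P∘L : deltaYS lam ≋ compS P L
  deltaYS≋P∘L n = begin
    EeYS lam n - oneS n
      ≈⟨ +-congʳ (sumTo-head n _) ⟩
    (inv 0 * 1# * oneS n + S) - oneS n
      ≈⟨ +-congʳ (+-congʳ (trans (*-congʳ (trans (*-identityʳ _) inv-0)) (*-identityˡ _))) ⟩
    (oneS n + S) - oneS n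
      ≈⟨ xyx⁻¹≈y (oneS n) S ⟩
    S
      ≈⟨ trans (+-congʳ (zeroˡ _)) (+-identityˡ _) ⟨
    0# * oneS n + S
      ≈⟨ sumTo-head n _ ⟨
    compS P L n ∎
    where
    S : Carrier
    S = sumTo n (λ j → inv (suc j) * invFact (suc j) * powS L (suc j) n)

  derivS-L : ∀ k → derivS L k ≈ pw (- 1#) k * pw lam k
  derivS-L k = trans (solve 3 (λ a b i → a :* (b :* i) := b :* (a :* i)) refl _ _ _)
                     (trans (*-congˡ (inv-correct k)) (*-identityʳ _))

  derivS-L*1+λt≋1 : mulS (derivS L) 1+λt ≋ oneS
  derivS-L*1+λt≋1 n = begin
    mulS L′ (oneS ⊕ mulS (constS lam) tS) n
      ≈⟨ solveS 3 (λ L′ l t → L′ ⊠ (conS 1 ⊞ l ⊠ t) ≐ L′ ⊞ l ⊠ (t ⊠ L′)) ≋-refl L′ (constS lam) tS n ⟩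
    L′ n + mulS (constS lam) (mulS tS L′) n
      ≈⟨ pointwise n ⟩
    oneS n ∎
    where
    L′ : PS
    L′ = derivS L
    pointwise : ∀ n → L′ n + mulS (constS lam) (mulS tS L′) n ≈ oneS n
    pointwise zero    = trans (+-cong (trans (derivS-L 0) (*-identityˡ _))
                                      (trans (constS-* lam (mulS tS L′) 0) (trans (*-congˡ (tS-*-at-0 L′)) (zeroʳ _))))
                              (+-identityʳ _)
    pointwise (suc k) = begin
      L′ (suc k) + mulS (constS lam) (mulS tS L′) (suc k)
        ≈⟨ +-cong (derivS-L (suc k)) (trans (constS-* lam (mulS tS L′) (suc k)) (*-congˡ (tS-*-at-suc L′ k))) ⟩
      (- 1# * pw (- 1#) k) * (lam * pw lam k) + lam * L′ k
        ≈⟨ +-congˡ (*-congˡ (derivS-L k)) ⟩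
      (- 1# * a) * (lam * b) + lam * (a * b)
        ≈⟨ +-congʳ (trans (solve 4 (λ m a l b → (m :* a) :* (l :* b) := m :* (l :* (a :* b))) refl _ _ _ _) (-1*x≈-x _)) ⟩
      - (lam * (a * b)) + lam * (a * b)
        ≈⟨ -‿inverseˡ _ ⟩
      0# ∎
      where
      a b : Carrier
      a = pw (- 1#) k
      b = pw lam k

  derivS-E : ∀ i → derivS E i ≈ pw lam i * invFact i
  derivS-E i = trans (solve 4 (λ n p f i → n :* (p :* (f :* i)) := p :* f :* (n :* i)) refl _ _ _ _)
                     (trans (*-congˡ (inv-correct i)) (*-identityʳ _))

  derivS-E≋1+λE : derivS E ≋ oneS ⊕ mulS (constS lam) E
  derivS-E≋1+λE zero    = begin
    derivS E 0                    ≈⟨ derivS-E 0 ⟩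
    1# * 1#                       ≈⟨ *-identityʳ 1# ⟩
    1#                            ≈⟨ +-identityʳ 1# ⟨
    1# + 0#                       ≈⟨ +-congˡ (trans (constS-* lam E 0) (zeroʳ lam)) ⟨
    1# + mulS (constS lam) E 0    ∎
  derivS-E≋1+λE (suc k) = begin
    derivS E (suc k)                                 ≈⟨ derivS-E (suc k) ⟩
    lam * pw lam k * invFact (suc k)                 ≈⟨ *-assoc _ _ _ ⟩
    lam * E (suc k)                                  ≈⟨ trans (+-identityˡ _) (constS-* lam E (suc k)) ⟨
    0# + mulS (constS lam) E (suc k)                 ∎

  L∘E≋t : compS L E ≋ tS
  L∘E≋t = derivS-injective (compS-at-0 {L} {E} refl) λ k → begin
    derivS (compS L E) k                            ≈⟨ derivS-compS refl L k ⟩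
    mulS (compS L′ E) (derivS E) k                  ≈⟨ mulS-congˡ (compS L′ E) 1+λt∘E≋E′ k ⟨
    mulS (compS L′ E) (compS 1+λt E) k              ≈⟨ compS-mulS refl L′ 1+λt k ⟨
    compS (mulS L′ 1+λt) E k                        ≈⟨ compS-congʳ E derivS-L*1+λt≋1 k ⟩
    compS oneS E k                                  ≈⟨ compS-oneS E k ⟩
    oneS k                                          ≈⟨ derivS-tS k ⟨
    derivS tS k                                     ∎
    where
    L′ : PS
    L′ = derivS L
    1+λt∘E≋E′ : compS 1+λt E ≋ derivS E
    1+λt∘E≋E′ n = begin
      compS 1+λt E n
        ≈⟨ compS-distrib-⊕ oneS (mulS (constS lam) tS) E n ⟩
      compS oneS E n + compS (mulS (constS lam) tS) E n
        ≈⟨ +-cong (compS-oneS E n) (trans (compS-constS-* lam tS E n) (mulS-congˡ (constS lam) (compS-identityˡ refl) n)) ⟩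
      oneS n + mulS (constS lam) E n
        ≈⟨ derivS-E≋1+λE n ⟨
      derivS E n ∎

module Corollary {c ℓ} (R : CommutativeRing c ℓ)
                 (inv : ℕ → CommutativeRing.Carrier R) (inv-correct : InvertsSuc R inv)
                 (lam : CommutativeRing.Carrier R) where
  open CommutativeRing R
  open Series R
  open WithInverses inv
  open FiniteSums R
  open NumeralsAndPowers R
  open SeriesRing R
  open Composition R
  open Derivative R
  open CompositionalInverse R
  open UnitFractions R inv inv-correct
  open A2Series R inv inv-correct
  open DegenerateLogarithm R inv inv-correct lam
  open LagrangeInversion R inv inv-correct using (lagrange-inversion)
  open NaturalSolver commutativeSemiring using (solve; _:*_; _:=_)
  open CommutativeSemigroupProperties *-commutativeSemigroup
    using (x∙yz≈y∙xz) renaming (interchange to *-interchange)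
  open import Relation.Binary.Reasoning.Setoid setoid

  -- rhsCoeff (n+1) = n! [tⁿ] rhsS′ is the binomial convolution of λⁱ = i! [tⁱ] E′ with
  -- 2ⁿ⁺¹ innerSum (n+1) j = j! [tʲ] Φⁿ⁺¹.
  derivS-rhsS : ∀ n → derivS (rhsS lam) n ≈ mulS (derivS E) (powS Φ (suc n)) n
  derivS-rhsS n = begin
    fromℕ (suc n) * (2ⁿ⁺¹ * S * (invFact n * inv n))
      ≈⟨ solve 5 (λ f a s i v → f :* (a :* s :* (i :* v)) := a :* (s :* i) :* (f :* v)) refl _ _ _ _ _ ⟩
    2ⁿ⁺¹ * (S * invFact n) * (fromℕ (suc n) * inv n)
      ≈⟨ trans (*-congˡ (inv-correct n)) (*-identityʳ _) ⟩
    2ⁿ⁺¹ * (S * invFact n)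
      ≈⟨ *-congˡ binomial-convolution ⟩
    2ⁿ⁺¹ * conv n (λ i j → pw lam i * invFact i * (IS j * invFact j))
      ≈⟨ *-distribˡ-conv n 2ⁿ⁺¹ _ ⟩
    conv n (λ i j → 2ⁿ⁺¹ * (pw lam i * invFact i * (IS j * invFact j)))
      ≈⟨ conv-cong n (λ i j → trans (x∙yz≈y∙xz _ _ _) (*-cong (sym (derivS-E i)) (coefficient-of-Φⁿ⁺¹ j))) ⟩
    conv n (λ i j → derivS E i * powS Φ (suc n) j)
      ≈⟨ mulS-conv (derivS E) (powS Φ (suc n)) n ⟨
    mulS (derivS E) (powS Φ (suc n)) n ∎
    where
    2ⁿ⁺¹ : Carrier
    2ⁿ⁺¹ = fromℕ (2 ℕ.^ suc n)
    IS : ℕ → Carrier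
    IS = innerSum (suc n)
    S : Carrier
    S = sumTo (suc n) (λ m → fromℕ (n C m) * IS m * pw lam (suc n ∸ m ∸ 1))

    coefficient-of-Φⁿ⁺¹ : ∀ j → 2ⁿ⁺¹ * (IS j * invFact j) ≈ powS Φ (suc n) j
    coefficient-of-Φⁿ⁺¹ j = trans (*-congʳ (fromℕ-^ 2 (suc n))) (sym (powS-Φ (suc n) j))

    suc∸∸1 : ∀ m → suc n ∸ m ∸ 1 ≡ n ∸ m
    suc∸∸1 m = ≡.trans (ℕₚ.∸-+-assoc (suc n) m 1) (≡.cong (suc n ∸_) (ℕₚ.+-comm m 1))

    binomial-convolution : S * invFact n ≈ conv n (λ i j → pw lam i * invFact i * (IS j * invFact j))
    binomial-convolution = begin
      S * invFact n
        ≈⟨ *-congʳ (sumTo-cong (suc n) (λ m → *-congˡ (reflexive (≡.cong (pw lam) (suc∸∸1 m))))) ⟩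
      sumTo (suc n) (λ m → fromℕ (n C m) * IS m * pw lam (n ∸ m)) * invFact n
        ≈⟨ *-congʳ (sumTo-conv n (λ m i → fromℕ (n C m) * IS m * pw lam i)) ⟩
      conv n (λ m i → fromℕ (n C m) * IS m * pw lam i) * invFact n
        ≈⟨ *-distribʳ-conv n _ _ ⟩
      conv n (λ m i → fromℕ (n C m) * IS m * pw lam i * invFact n)
        ≈⟨ conv-cong-+ n (λ m i m+i≡n → trans (solve 4 (λ C I p F → C :* I :* p :* F := I :* p :* (C :* F)) refl _ _ _ _)
                                               (*-congˡ (fromℕC-*-invFact m i m+i≡n))) ⟩
      conv n (λ m i → IS m * pw lam i * (invFact m * invFact i))
        ≈⟨ conv-cong n (λ m i → *-interchange _ _ _ _) ⟩
      conv n (λ m i → IS m * invFact m * (pw lam i * invFact i))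
        ≈⟨ conv-comm n _ ⟩
      conv n (λ i j → IS j * invFact j * (pw lam i * invFact i))
        ≈⟨ conv-cong n (λ i j → *-comm _ _) ⟩
      conv n (λ i j → pw lam i * invFact i * (IS j * invFact j)) ∎

  P⁻¹-exists : Σ PS (IsCompInverse P)
  P⁻¹-exists = compInverse-exists (Φ 0) refl P₁*Φ₀≈1

  P⁻¹ : PS
  P⁻¹ = proj₁ P⁻¹-exists

  P⁻¹-at-0 : P⁻¹ 0 ≈ 0#
  P⁻¹-at-0 = proj₁ (proj₂ P⁻¹-exists)

  -- Lagrange inversion for h = E ∘ P⁻¹ (so that h ∘ P = E) identifies the right-hand side.
  rhsS≋E∘P⁻¹ : rhsS lam ≋ compS E P⁻¹
  rhsS≋E∘P⁻¹ = derivS-injective (sym (compS-at-0 {E} {P⁻¹} refl)) λ n → begin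
    derivS (rhsS lam) n                                        ≈⟨ derivS-rhsS n ⟩
    mulS (derivS E) (powS Φ (suc n)) n                         ≈⟨ mulS-congʳ (powS Φ (suc n)) (derivS-cong E∘P⁻¹∘P≋E) n ⟨
    mulS (derivS (compS (compS E P⁻¹) P)) (powS Φ (suc n)) n   ≈⟨ lagrange-inversion P Φ refl Φ*P₊≋1 (compS E P⁻¹) n ⟩
    derivS (compS E P⁻¹) n                                     ∎
    where
    E∘P⁻¹∘P≋E : compS (compS E P⁻¹) P ≋ E
    E∘P⁻¹∘P≋E n = begin
      compS (compS E P⁻¹) P n   ≈⟨ compS-assoc P⁻¹-at-0 refl E n ⟩
      compS E (compS P⁻¹ P) n   ≈⟨ compS-congˡ E (proj₂ (IsCompInverse-sym (proj₂ P⁻¹-exists))) n ⟩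
      compS E tS n              ≈⟨ compS-identityʳ E n ⟩
      E n                       ∎

  rhsS-isCompInverse : IsCompInverse (deltaYS lam) (rhsS lam)
  rhsS-isCompInverse = refl , λ n → begin
    compS (deltaYS lam) (rhsS lam) n        ≈⟨ compS-cong deltaYS≋P∘L rhsS≋E∘P⁻¹ n ⟩
    compS (compS P L) (compS E P⁻¹) n       ≈⟨ compS-assoc refl (compS-at-0 {E} {P⁻¹} refl) P n ⟩
    compS P (compS L (compS E P⁻¹)) n       ≈⟨ compS-congˡ P (compS-assoc refl P⁻¹-at-0 L) n ⟨
    compS P (compS (compS L E) P⁻¹) n       ≈⟨ compS-congˡ P (compS-congʳ P⁻¹ L∘E≋t) n ⟩
    compS P (compS tS P⁻¹) n                ≈⟨ compS-congˡ P (compS-identityˡ P⁻¹-at-0) n ⟩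
    compS P P⁻¹ n                           ≈⟨ proj₂ (proj₂ P⁻¹-exists) n ⟩
    tS n                                    ∎

corollary5p4 : {c ℓ : Level} (R : CommutativeRing c ℓ) →
  let open CommutativeRing R
      open Series R
  in (inv : ℕ → Carrier) → (∀ n → fromℕ (suc n) * inv n ≈ 1#) →
     (lam : Carrier) → ¬ (lam ≈ 0#) →
     let open WithInverses inv
     in IsCompInverse (deltaYS lam) (rhsS lam)
        × (∀ (logY : PS) → IsCompInverse (deltaYS lam) logY →
             ∀ n → fromℕ ((suc n) !) * logY (suc n) ≈ rhsCoeff lam (suc n))
corollary5p4 R inv inv-correct lam _ = rhsS-isCompInverse , coefficients
  where
  open CommutativeRing R
  open Series R
  open WithInverses inv
  open Corollary R inv inv-correct lam using (rhsS-isCompInverse)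
  open CompositionalInverse R using (IsCompInverse-unique)
  open UnitFractions R inv inv-correct using (fromℕ-!-*-invFact)
  open CommutativeSemigroupProperties *-commutativeSemigroup using (x∙yz≈y∙xz)
  open import Relation.Binary.Reasoning.Setoid setoid

  coefficients : ∀ logY → IsCompInverse (deltaYS lam) logY →
                 ∀ n → fromℕ ((suc n) !) * logY (suc n) ≈ rhsCoeff lam (suc n)
  coefficients logY logY-isCompInverse n = begin
    fromℕ (suc n !) * logY (suc n)
      ≈⟨ *-congˡ (IsCompInverse-unique rhsS-isCompInverse logY-isCompInverse (suc n)) ⟩
    fromℕ (suc n !) * (rhsCoeff lam (suc n) * invFact (suc n))
      ≈⟨ x∙yz≈y∙xz _ _ _ ⟩
    rhsCoeff lam (suc n) * (fromℕ (suc n !) * invFact (suc n))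
      ≈⟨ *-congˡ (fromℕ-!-*-invFact (suc n)) ⟩
    rhsCoeff lam (suc n) * 1#
      ≈⟨ *-identityʳ _ ⟩
    rhsCoeff lam (suc n) ∎
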